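{- Reduction on (untyped) $\lambda\mu$T-terms is confluent: if $t_1\twoheadrightarrow t_2$ and $t_1\twoheadrightarrow t_3$, then there exists a term $t_4$ with $t_2\twoheadrightarrow t_4$ and $t_3\twoheadrightarrow t_4$.
   Context: $\lambda\mu$T raw terms/commands: $t,r,s ::= x\mid\lambda x.r\mid ts\mid\mu\alpha.c\mid0\mid\mathsf S\,t\mid\mathsf{nrec}\ r\ s\ t$, $c::=[\alpha]t$ ($x$ $\lambda$-variables, $\alpha$ $\mu$-variables; no typing assumed; terms up to renaming of bound variables); $\mathrm{FCV}$: free $\mu$-variables; $\overline n:=\mathsf S^n0$. Contexts $E ::= \Box \mid E\,t \mid \mathsf S\,E \mid \mathsf{nrec}\ r\ s\ E$; $E[t]$ fills the hole. Structural substitution $t[\alpha:=\beta E]$ replaces recursively each subcommand $[\alpha]q$ of $t$ by $[\beta]E[q[\alpha:=\beta E]]$ (capture-avoiding). Reduction $\to$ is the compatible closure (on terms and commands) of: $(\lambda x.t)r \to t[x:=r]$; $\mathsf S(\mu\alpha.c)\to \mu\alpha.c[\alpha:=\alpha(\mathsf S\Box)]$; $(\mu\alpha.c)s\to\mu\alpha.c[\alpha:=\alpha(\Box s)]$; $\mu\alpha.[\alpha]t\to t$ if $\alpha\notin\mathrm{FCV}(t)$; $[\alpha]\mu\beta.c\to c[\beta:=\alpha\,\Box]$; $\mathsf{nrec}\ r\ s\ 0\to r$; $\mathsf{nrec}\ r\ s\ (\mathsf S\,\overline n)\to s\ \overline n\ (\mathsf{nrec}\ r\ s\ \overline n)$;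 $\mathsf{nrec}\ r\ s\ (\mu\alpha.c)\to\mu\alpha.c[\alpha:=\alpha(\mathsf{nrec}\ r\ s\ \Box)]$. $\twoheadrightarrow$ is its reflexive–transitive closure. -}

module Defs where

-- Untyped λμT, well-scoped de Bruijn syntax.
-- Tm n m : terms with (at most) n free λ-variables and m free μ-variables.
-- De Bruijn indices make terms equal up to renaming of bound variables.

open import Data.Nat using (ℕ; zero; suc)
open import Data.Fin using (Fin; zero; suc)
open import Data.Product using (_×_; _,_; proj₁; proj₂)
open import Function using (id)
open import Relation.Binary.Construct.Closure.ReflexiveTransitive using (Star)

data Tm : ℕ → ℕ → Set
data Cmd : ℕ → ℕ → Set

data Tm where
  var  : ∀ {n m} → Fin n → Tm n m
  lam  : ∀ {n m} → Tm (suc n) m → Tm n m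
  app  : ∀ {n m} → Tm n m → Tm n m → Tm n m
  mu   : ∀ {n m} → Cmd n (suc m) → Tm n m
  ze   : ∀ {n m} → Tm n m
  S    : ∀ {n m} → Tm n m → Tm n m
  nrec : ∀ {n m} → Tm n m → Tm n m → Tm n m → Tm n m

-- cmd α t  is the command [α]t
data Cmd where
  cmd : ∀ {n m} → Fin m → Tm n m → Cmd n m

num : ∀ {n m} → ℕ → Tm n m
num zero    = ze
num (suc k) = S (num k)

data Ctx (n m : ℕ) : Set where
  □     : Ctx n m
  _·_   : Ctx n m → Tm n m → Ctx n m
  SC    : Ctx n m → Ctx n m
  nrecC : Tm n m → Tm n m → Ctx n m → Ctx n m

plug : ∀ {n m} → Ctx n m → Tm n m → Tm n m
plug □             q = q
plug (E · t)       q = app (plug E q) t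
plug (SC E)        q = S (plug E q)
plug (nrecC r s E) q = nrec r s (plug E q)

liftR : ∀ {k k'} → (Fin k → Fin k') → Fin (suc k) → Fin (suc k')
liftR ρ zero    = zero
liftR ρ (suc i) = suc (ρ i)

ren  : ∀ {n n' m m'} → (Fin n → Fin n') → (Fin m → Fin m') → Tm n m → Tm n' m'
renc : ∀ {n n' m m'} → (Fin n → Fin n') → (Fin m → Fin m') → Cmd n m → Cmd n' m'
ren ρ θ (var x)      = var (ρ x)
ren ρ θ (lam t)      = lam (ren (liftR ρ) θ t)
ren ρ θ (app t s)    = app (ren ρ θ t) (ren ρ θ s)
ren ρ θ (mu c)       = mu (renc ρ (liftR θ) c)
ren ρ θ ze           = ze
ren ρ θ (S t)        = S (ren ρ θ t)
ren ρ θ (nrec r s t) = nrec (ren ρ θ r) (ren ρ θ s) (ren ρ θ t)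
renc ρ θ (cmd α t)   = cmd (θ α) (ren ρ θ t)

renCtx : ∀ {n n' m m'} → (Fin n → Fin n') → (Fin m → Fin m') → Ctx n m → Ctx n' m'
renCtx ρ θ □             = □
renCtx ρ θ (E · t)       = renCtx ρ θ E · ren ρ θ t
renCtx ρ θ (SC E)        = SC (renCtx ρ θ E)
renCtx ρ θ (nrecC r s E) = nrecC (ren ρ θ r) (ren ρ θ s) (renCtx ρ θ E)

wkμ : ∀ {n m} → Tm n m → Tm n (suc m)
wkμ = ren id suc

liftS : ∀ {n n' m} → (Fin n → Tm n' m) → Fin (suc n) → Tm (suc n') m
liftS σ zero    = var zero
liftS σ (suc i) = ren suc id (σ i)

liftSμ : ∀ {n n' m} → (Fin n → Tm n' m) → Fin n → Tm n' (suc m)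
liftSμ σ i = ren id suc (σ i)

sub  : ∀ {n n' m} → (Fin n → Tm n' m) → Tm n m → Tm n' m
subc : ∀ {n n' m} → (Fin n → Tm n' m) → Cmd n m → Cmd n' m
sub σ (var x)      = σ x
sub σ (lam t)      = lam (sub (liftS σ) t)
sub σ (app t s)    = app (sub σ t) (sub σ s)
sub σ (mu c)       = mu (subc (liftSμ σ) c)
sub σ ze           = ze
sub σ (S t)        = S (sub σ t)
sub σ (nrec r s t) = nrec (sub σ r) (sub σ s) (sub σ t)
subc σ (cmd α t)   = cmd α (sub σ t)

_[_] : ∀ {n m} → Tm (suc n) m → Tm n m → Tm n m
t [ r ] = sub (λ { zero → r ; (suc i) → var i }) t

-- Structural substitution (simultaneous): each μ-variable α is mapped
-- to a pair (β , E); every subcommand [α]q becomes [β]E[q[σ]].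

SSub : ℕ → ℕ → ℕ → Set
SSub n m m' = Fin m → Fin m' × Ctx n m'

liftSSλ : ∀ {n m m'} → SSub n m m' → SSub (suc n) m m'
liftSSλ σ α = proj₁ (σ α) , renCtx suc id (proj₂ (σ α))

liftSSμ : ∀ {n m m'} → SSub n m m' → SSub n (suc m) (suc m')
liftSSμ σ zero    = zero , □
liftSSμ σ (suc α) = suc (proj₁ (σ α)) , renCtx id suc (proj₂ (σ α))

ssub  : ∀ {n m m'} → SSub n m m' → Tm n m → Tm n m'
ssubc : ∀ {n m m'} → SSub n m m' → Cmd n m → Cmd n m'
ssub σ (var x)      = var x
ssub σ (lam t)      = lam (ssub (liftSSλ σ) t)
ssub σ (app t s)    = app (ssub σ t) (ssub σ s)
ssub σ (mu c)       = mu (ssubc (liftSSμ σ) c)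
ssub σ ze           = ze
ssub σ (S t)        = S (ssub σ t)
ssub σ (nrec r s t) = nrec (ssub σ r) (ssub σ s) (ssub σ t)
ssubc σ (cmd α q)   = cmd (proj₁ (σ α)) (plug (proj₂ (σ α)) (ssub σ q))

[0≔0_] : ∀ {n m} → Ctx n (suc m) → SSub n (suc m) (suc m)
[0≔0 E ] zero    = zero , E
[0≔0 E ] (suc α) = suc α , □

[0≔_□] : ∀ {n m} → Fin m → SSub n (suc m) m
[0≔ α □] zero    = α , □
[0≔ α □] (suc γ) = γ , □

infix 4 _⟶_ _⟶c_

data _⟶_ : ∀ {n m} → Tm n m → Tm n m → Set
data _⟶c_ : ∀ {n m} → Cmd n m → Cmd n m → Set

data _⟶_ where
  β       : ∀ {n m} {t : Tm (suc n) m} {r : Tm n m} →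
            app (lam t) r ⟶ t [ r ]
  μS      : ∀ {n m} {c : Cmd n (suc m)} →
            S (mu c) ⟶ mu (ssubc [0≔0 SC □ ] c)
  μapp    : ∀ {n m} {c : Cmd n (suc m)} {s : Tm n m} →
            app (mu c) s ⟶ mu (ssubc [0≔0 □ · wkμ s ] c)
  μη      : ∀ {n m} {t : Tm n m} →               -- α ∉ FCV(t)
            mu (cmd zero (wkμ t)) ⟶ t
  nrec0   : ∀ {n m} {r s : Tm n m} →
            nrec r s ze ⟶ r
  nrecS   : ∀ {n m} {r s : Tm n m} (k : ℕ) →
            nrec r s (S (num k)) ⟶ app (app s (num k)) (nrec r s (num k))
  nrecμ   : ∀ {n m} {r s : Tm n m} {c : Cmd n (suc m)} →
            nrec r s (mu c) ⟶ mu (ssubc [0≔0 nrecC (wkμ r) (wkμ s) □ ] c)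
  ξlam    : ∀ {n m} {t t' : Tm (suc n) m} → t ⟶ t' → lam t ⟶ lam t'
  ξappL   : ∀ {n m} {t t' s : Tm n m} → t ⟶ t' → app t s ⟶ app t' s
  ξappR   : ∀ {n m} {t s s' : Tm n m} → s ⟶ s' → app t s ⟶ app t s'
  ξmu     : ∀ {n m} {c c' : Cmd n (suc m)} → c ⟶c c' → mu c ⟶ mu c'
  ξS      : ∀ {n m} {t t' : Tm n m} → t ⟶ t' → S t ⟶ S t'
  ξnrec₁  : ∀ {n m} {r r' s t : Tm n m} → r ⟶ r' → nrec r s t ⟶ nrec r' s t
  ξnrec₂  : ∀ {n m} {r s s' t : Tm n m} → s ⟶ s' → nrec r s t ⟶ nrec r s' t
  ξnrec₃  : ∀ {n m} {r s t t' : Tm n m} → t ⟶ t' → nrec r s t ⟶ nrec r s t'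

data _⟶c_ where
  μcmd    : ∀ {n m} {α : Fin m} {c : Cmd n (suc m)} →
            cmd α (mu c) ⟶c ssubc [0≔ α □] c
  ξcmd    : ∀ {n m} {α : Fin m} {t t' : Tm n m} → t ⟶ t' → cmd α t ⟶c cmd α t'

infix 4 _↠_
_↠_ : ∀ {n m} → Tm n m → Tm n m → Set
_↠_ = Star _⟶_

-- The reduction ⟶ is split into two relations: parallel reduction _⇒_, which
-- contracts any set of redexes except μη, and the compatible closure _→η_ of
-- μη (μα.[α]t → t).  Then  ⟶ ⊆ (⇒ ∪ →η) ⊆ ⟶*,  so it suffices that ⇒ ∪ →η is
-- confluent, which follows from the Hindley–Rosen lemma and three one-step
-- squares:
--   * ⇒ has the diamond property, via Takahashi's complete development
--     (par-triangle);
--   * →η strongly commutes with itself (η-square);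
--   * ⇒ and →η commute in one step (par-η-square).
module Submission where

open import Defs
open import Data.Nat using (ℕ; zero; suc)
open import Data.Fin using (Fin; zero; suc)
open import Data.Fin.Properties using (suc-injective)
open import Data.Maybe using (Maybe; just; nothing)
import Data.Maybe as Maybe
open import Data.Product using (Σ; ∃; _×_; _,_; proj₁; proj₂)
open import Data.Sum using (_⊎_; inj₁; inj₂)
import Data.Sum as Sum
open import Data.Empty using (⊥; ⊥-elim)
open import Function using (id; _∘_)
open import Function.Definitions using (Injective)
open import Relation.Binary.PropositionalEquality
  using (_≡_; _≗_; refl; sym; trans; cong; cong₂; subst; subst₂; module ≡-Reasoning)
open import Relation.Binary.Construct.Closure.ReflexiveTransitive
  using (Star; ε; _◅_; _◅◅_; gmap; _⋆)
open import Relation.Binary.Construct.Closure.Reflexive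
  using (ReflClosure) renaming (refl to no-step; [_] to one-step; map to map⁼)
open import Relation.Binary.Construct.Union using (_∪_)
open import Relation.Binary.Rewriting using (Confluent)
open ≡-Reasoning

module Commutation {A : Set} where

  Commute : (A → A → Set) → (A → A → Set) → Set
  Commute R Q = ∀ {a b c} → Star R a b → Star Q a c → ∃ λ d → Star Q b d × Star R c d

  commute-sym : ∀ {R Q : A → A → Set} → Commute R Q → Commute Q R
  commute-sym C qs rs with C rs qs
  ... | d , qs′ , rs′ = d , rs′ , qs′

  StronglyCommute : (A → A → Set) → (A → A → Set) → Set
  StronglyCommute R Q = ∀ {a b c} → R a b → Q a c → ∃ λ d → Star Q b d × ReflClosure R c d

  _⁼◅◅_ : ∀ {R : A → A → Set} {a b c} → ReflClosure R a b → Star R b c → Star R a c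
  no-step    ⁼◅◅ rs = rs
  one-step r ⁼◅◅ rs = r ◅ rs

  strip : ∀ {R Q : A → A → Set} → StronglyCommute R Q →
          ∀ {a b c} → R a b → Star Q a c → ∃ λ d → Star Q b d × ReflClosure R c d
  strip H r ε = _ , ε , one-step r
  strip H r (q ◅ qs) with H r q
  ... | d , qs₁ , no-step = _ , qs₁ ◅◅ qs , no-step
  ... | d , qs₁ , one-step r′ with strip H r′ qs
  ...   | e , qs₂ , r″ = e , qs₁ ◅◅ qs₂ , r″

  strongly-commute⇒commute : ∀ {R Q : A → A → Set} → StronglyCommute R Q → Commute R Q
  strongly-commute⇒commute H ε qs = _ , qs , ε
  strongly-commute⇒commute H (r ◅ rs) qs with strip H r qs
  ... | d₁ , qs₁ , r₁ with strongly-commute⇒commute H rs qs₁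
  ...   | d , qs₂ , rs₂ = d , qs₂ , r₁ ⁼◅◅ rs₂

  commute-∪ʳ : ∀ {C R Q : A → A → Set} → Commute C R → Commute C Q → Commute C (R ∪ Q)
  commute-∪ʳ cr cq cs ε = _ , ε , cs
  commute-∪ʳ cr cq cs (inj₁ r ◅ us) with cr cs (r ◅ ε)
  ... | d₁ , rs , cs₁ with commute-∪ʳ cr cq cs₁ us
  ...   | d , us₁ , cs₂ = d , gmap id inj₁ rs ◅◅ us₁ , cs₂
  commute-∪ʳ cr cq cs (inj₂ q ◅ us) with cq cs (q ◅ ε)
  ... | d₁ , qs , cs₁ with commute-∪ʳ cr cq cs₁ us
  ...   | d , us₁ , cs₂ = d , gmap id inj₂ qs ◅◅ us₁ , cs₂

  commute-∪ˡ : ∀ {C R Q : A → A → Set} → Commute R C → Commute Q C → Commute (R ∪ Q) C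
  commute-∪ˡ rc qc = commute-sym (commute-∪ʳ (commute-sym rc) (commute-sym qc))

  hindley-rosen : ∀ {R Q : A → A → Set} → Confluent R → Confluent Q → Commute R Q → Confluent (R ∪ Q)
  hindley-rosen rr qq rq = commute-∪ˡ (commute-∪ʳ rr rq) (commute-∪ʳ (commute-sym rq) qq)

  -- Confluence transfers from Q to R when R ⊆ Q ⊆ R*, because then R* = Q*.
  confluent-between : ∀ {R Q : A → A → Set} → (∀ {a b} → R a b → Q a b) → (∀ {a b} → Q a b → Star R a b) →
                      Confluent Q → Confluent R
  confluent-between R⊆Q Q⊆R* conf rs₁ rs₂ with conf (gmap id R⊆Q rs₁) (gmap id R⊆Q rs₂)
  ... | d , qs₁ , qs₂ = d , (Q⊆R* ⋆) qs₁ , (Q⊆R* ⋆) qs₂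

open Commutation

variable
  n m n₁ n₂ n₃ m₁ m₂ m₃ : ℕ

infixr 20 _∘E_
_∘E_ : Ctx n m → Ctx n m → Ctx n m
□           ∘E F = F
(E · t)     ∘E F = (E ∘E F) · t
SC E        ∘E F = SC (E ∘E F)
nrecC r s E ∘E F = nrecC r s (E ∘E F)

plug-∘ : (E F : Ctx n m) (q : Tm n m) → plug (E ∘E F) q ≡ plug E (plug F q)
plug-∘ □             F q = refl
plug-∘ (E · t)       F q = cong (λ z → app z t) (plug-∘ E F q)
plug-∘ (SC E)        F q = cong S (plug-∘ E F q)
plug-∘ (nrecC r s E) F q = cong (nrec r s) (plug-∘ E F q)

∘E-□ : (E : Ctx n m) → E ∘E □ ≡ E
∘E-□ □             = refl
∘E-□ (E · t)       = cong (_· t) (∘E-□ E)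
∘E-□ (SC E)        = cong SC (∘E-□ E)
∘E-□ (nrecC r s E) = cong (nrecC r s) (∘E-□ E)

-- The command [β]E[q] determined by an entry (β , E) of a structural substitution;
-- ssubc τ (cmd α q) is by definition  τ α ⟨ ssub τ q ⟩.
_⟨_⟩ : Fin m × Ctx n m → Tm n m → Cmd n m
p ⟨ q ⟩ = cmd (proj₁ p) (plug (proj₂ p) q)

plug-ren : ∀ {ρ : Fin n₁ → Fin n₂} {θ : Fin m₁ → Fin m₂} (E : Ctx n₁ m₁) (q : Tm n₁ m₁) →
           ren ρ θ (plug E q) ≡ plug (renCtx ρ θ E) (ren ρ θ q)
plug-ren □             q = refl
plug-ren (E · t)       q = cong (λ z → app z _) (plug-ren E q)
plug-ren (SC E)        q = cong S (plug-ren E q)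
plug-ren (nrecC r s E) q = cong (nrec _ _) (plug-ren E q)

renCtx-∘ : ∀ {ρ : Fin n₁ → Fin n₂} {θ : Fin m₁ → Fin m₂} (E F : Ctx n₁ m₁) →
           renCtx ρ θ (E ∘E F) ≡ renCtx ρ θ E ∘E renCtx ρ θ F
renCtx-∘ □             F = refl
renCtx-∘ (E · t)       F = cong (_· _) (renCtx-∘ E F)
renCtx-∘ (SC E)        F = cong SC (renCtx-∘ E F)
renCtx-∘ (nrecC r s E) F = cong (nrecC _ _) (renCtx-∘ E F)

liftR-fuse : ∀ {k₁ k₂ k₃} {ρ₁ : Fin k₁ → Fin k₂} {ρ₂ : Fin k₂ → Fin k₃} {ρ : Fin k₁ → Fin k₃} →
             ρ₂ ∘ ρ₁ ≗ ρ → liftR ρ₂ ∘ liftR ρ₁ ≗ liftR ρ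
liftR-fuse h zero    = refl
liftR-fuse h (suc x) = cong suc (h x)

ren-ren : ∀ {ρ₁ : Fin n₁ → Fin n₂} {θ₁ : Fin m₁ → Fin m₂} {ρ₂ : Fin n₂ → Fin n₃} {θ₂ : Fin m₂ → Fin m₃} {ρ θ} →
          ρ₂ ∘ ρ₁ ≗ ρ → θ₂ ∘ θ₁ ≗ θ → ∀ t → ren ρ₂ θ₂ (ren ρ₁ θ₁ t) ≡ ren ρ θ t
renc-renc : ∀ {ρ₁ : Fin n₁ → Fin n₂} {θ₁ : Fin m₁ → Fin m₂} {ρ₂ : Fin n₂ → Fin n₃} {θ₂ : Fin m₂ → Fin m₃} {ρ θ} →
            ρ₂ ∘ ρ₁ ≗ ρ → θ₂ ∘ θ₁ ≗ θ → ∀ c → renc ρ₂ θ₂ (renc ρ₁ θ₁ c) ≡ renc ρ θ c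
ren-ren h h′ (var x)      = cong var (h x)
ren-ren h h′ (lam t)      = cong lam (ren-ren (liftR-fuse h) h′ t)
ren-ren h h′ (app t s)    = cong₂ app (ren-ren h h′ t) (ren-ren h h′ s)
ren-ren h h′ (mu c)       = cong mu (renc-renc h (liftR-fuse h′) c)
ren-ren h h′ ze           = refl
ren-ren h h′ (S t)        = cong S (ren-ren h h′ t)
ren-ren h h′ (nrec r s t) = cong₂ (λ a b → a b) (cong₂ nrec (ren-ren h h′ r) (ren-ren h h′ s)) (ren-ren h h′ t)
renc-renc h h′ (cmd α t)  = cong₂ cmd (h′ α) (ren-ren h h′ t)

renCtx-renCtx : ∀ {ρ₁ : Fin n₁ → Fin n₂} {θ₁ : Fin m₁ → Fin m₂} {ρ₂ : Fin n₂ → Fin n₃} {θ₂ : Fin m₂ → Fin m₃} {ρ θ} →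
                ρ₂ ∘ ρ₁ ≗ ρ → θ₂ ∘ θ₁ ≗ θ → ∀ E → renCtx ρ₂ θ₂ (renCtx ρ₁ θ₁ E) ≡ renCtx ρ θ E
renCtx-renCtx h h′ □             = refl
renCtx-renCtx h h′ (E · t)       = cong₂ _·_ (renCtx-renCtx h h′ E) (ren-ren h h′ t)
renCtx-renCtx h h′ (SC E)        = cong SC (renCtx-renCtx h h′ E)
renCtx-renCtx h h′ (nrecC r s E) =
  cong₂ (λ a b → a b) (cong₂ nrecC (ren-ren h h′ r) (ren-ren h h′ s)) (renCtx-renCtx h h′ E)

ren-comm : ∀ {n₁′ m₁′} {ρ₁ : Fin n₁ → Fin n₂} {θ₁ : Fin m₁ → Fin m₂} {ρ₂ : Fin n₂ → Fin n₃} {θ₂ : Fin m₂ → Fin m₃}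
           {ρ₁′ : Fin n₁ → Fin n₁′} {θ₁′ : Fin m₁ → Fin m₁′} {ρ₂′ : Fin n₁′ → Fin n₃} {θ₂′ : Fin m₁′ → Fin m₃} →
           ρ₂ ∘ ρ₁ ≗ ρ₂′ ∘ ρ₁′ → θ₂ ∘ θ₁ ≗ θ₂′ ∘ θ₁′ → ∀ t →
           ren ρ₂ θ₂ (ren ρ₁ θ₁ t) ≡ ren ρ₂′ θ₂′ (ren ρ₁′ θ₁′ t)
ren-comm h h′ t = trans (ren-ren h h′ t) (sym (ren-ren (λ _ → refl) (λ _ → refl) t))

renCtx-comm : ∀ {n₁′ m₁′} {ρ₁ : Fin n₁ → Fin n₂} {θ₁ : Fin m₁ → Fin m₂} {ρ₂ : Fin n₂ → Fin n₃} {θ₂ : Fin m₂ → Fin m₃}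
              {ρ₁′ : Fin n₁ → Fin n₁′} {θ₁′ : Fin m₁ → Fin m₁′} {ρ₂′ : Fin n₁′ → Fin n₃} {θ₂′ : Fin m₁′ → Fin m₃} →
              ρ₂ ∘ ρ₁ ≗ ρ₂′ ∘ ρ₁′ → θ₂ ∘ θ₁ ≗ θ₂′ ∘ θ₁′ → ∀ E →
              renCtx ρ₂ θ₂ (renCtx ρ₁ θ₁ E) ≡ renCtx ρ₂′ θ₂′ (renCtx ρ₁′ θ₁′ E)
renCtx-comm h h′ E = trans (renCtx-renCtx h h′ E) (sym (renCtx-renCtx (λ _ → refl) (λ _ → refl) E))

wkμ-ren : ∀ {ρ : Fin n₁ → Fin n₂} {θ : Fin m₁ → Fin m₂} (t : Tm n₁ m₁) →
          ren ρ (liftR θ) (wkμ t) ≡ wkμ (ren ρ θ t)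
wkμ-ren = ren-comm (λ _ → refl) (λ _ → refl)

liftR-id : ∀ {k} {ρ : Fin k → Fin k} → ρ ≗ id → liftR ρ ≗ id
liftR-id h zero    = refl
liftR-id h (suc x) = cong suc (h x)

ren-id : ∀ {ρ : Fin n → Fin n} {θ : Fin m → Fin m} → ρ ≗ id → θ ≗ id → ∀ t → ren ρ θ t ≡ t
renc-id : ∀ {ρ : Fin n → Fin n} {θ : Fin m → Fin m} → ρ ≗ id → θ ≗ id → ∀ c → renc ρ θ c ≡ c
ren-id h h′ (var x)      = cong var (h x)
ren-id h h′ (lam t)      = cong lam (ren-id (liftR-id h) h′ t)
ren-id h h′ (app t s)    = cong₂ app (ren-id h h′ t) (ren-id h h′ s)
ren-id h h′ (mu c)       = cong mu (renc-id h (liftR-id h′) c)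
ren-id h h′ ze           = refl
ren-id h h′ (S t)        = cong S (ren-id h h′ t)
ren-id h h′ (nrec r s t) = cong₂ (λ a b → a b) (cong₂ nrec (ren-id h h′ r) (ren-id h h′ s)) (ren-id h h′ t)
renc-id h h′ (cmd α t)   = cong₂ cmd (h′ α) (ren-id h h′ t)

ren-ext : ∀ {ρ ρ′ : Fin n₁ → Fin n₂} {θ θ′ : Fin m₁ → Fin m₂} → ρ ≗ ρ′ → θ ≗ θ′ → ∀ t → ren ρ θ t ≡ ren ρ′ θ′ t
ren-ext h h′ t = trans (sym (ren-id (λ _ → refl) (λ _ → refl) _)) (ren-ren h h′ t)

-- Mixed substitution: a λ-substitution σ and a structural substitution τ performed
-- in one traversal.  Renaming, λ-substitution and structural substitution are its
-- instances (ren≡msub, sub≡msub, ssub≡msub), so the three fusion laws below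
-- govern every interaction between them.
msub  : (Fin n₁ → Tm n₂ m₂) → SSub n₂ m₁ m₂ → Tm n₁ m₁ → Tm n₂ m₂
msubc : (Fin n₁ → Tm n₂ m₂) → SSub n₂ m₁ m₂ → Cmd n₁ m₁ → Cmd n₂ m₂
msub σ τ (var x)      = σ x
msub σ τ (lam t)      = lam (msub (liftS σ) (liftSSλ τ) t)
msub σ τ (app t s)    = app (msub σ τ t) (msub σ τ s)
msub σ τ (mu c)       = mu (msubc (liftSμ σ) (liftSSμ τ) c)
msub σ τ ze           = ze
msub σ τ (S t)        = S (msub σ τ t)
msub σ τ (nrec r s t) = nrec (msub σ τ r) (msub σ τ s) (msub σ τ t)
msubc σ τ (cmd α t)   = τ α ⟨ msub σ τ t ⟩

msubE : (Fin n₁ → Tm n₂ m₂) → SSub n₂ m₁ m₂ → Ctx n₁ m₁ → Ctx n₂ m₂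
msubE σ τ □             = □
msubE σ τ (E · t)       = msubE σ τ E · msub σ τ t
msubE σ τ (SC E)        = SC (msubE σ τ E)
msubE σ τ (nrecC r s E) = nrecC (msub σ τ r) (msub σ τ s) (msubE σ τ E)

plug-msub : ∀ {σ : Fin n₁ → Tm n₂ m₂} {τ : SSub n₂ m₁ m₂} (E : Ctx n₁ m₁) (q : Tm n₁ m₁) →
            msub σ τ (plug E q) ≡ plug (msubE σ τ E) (msub σ τ q)
plug-msub □             q = refl
plug-msub (E · t)       q = cong (λ z → app z _) (plug-msub E q)
plug-msub (SC E)        q = cong S (plug-msub E q)
plug-msub (nrecC r s E) q = cong (nrec _ _) (plug-msub E q)

-- Lifting a structural
-- substitution renames its entries: liftSSλ τ α = renEntry suc id (τ α) and
-- liftSSμ τ (suc α) = renEntry id suc (τ α).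
renEntry : (Fin n₁ → Fin n₂) → (Fin m₁ → Fin m₂) → Fin m₁ × Ctx n₁ m₁ → Fin m₂ × Ctx n₂ m₂
renEntry ρ θ p = θ (proj₁ p) , renCtx ρ θ (proj₂ p)

renEntry-comm : ∀ {n₁′ m₁′} {ρ₁ : Fin n₁ → Fin n₂} {θ₁ : Fin m₁ → Fin m₂} {ρ₂ : Fin n₂ → Fin n₃} {θ₂ : Fin m₂ → Fin m₃}
                {ρ₁′ : Fin n₁ → Fin n₁′} {θ₁′ : Fin m₁ → Fin m₁′} {ρ₂′ : Fin n₁′ → Fin n₃} {θ₂′ : Fin m₁′ → Fin m₃} →
                ρ₂ ∘ ρ₁ ≗ ρ₂′ ∘ ρ₁′ → θ₂ ∘ θ₁ ≗ θ₂′ ∘ θ₁′ → ∀ p →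
                renEntry ρ₂ θ₂ (renEntry ρ₁ θ₁ p) ≡ renEntry ρ₂′ θ₂′ (renEntry ρ₁′ θ₁′ p)
renEntry-comm h h′ p = cong₂ _,_ (h′ (proj₁ p)) (renCtx-comm h h′ (proj₂ p))

liftS-ren : ∀ {k} {σ : Fin n₂ → Tm k m} {ρ : Fin n₁ → Fin n₂} {σ′ : Fin n₁ → Tm k m} →
            σ ∘ ρ ≗ σ′ → liftS σ ∘ liftR ρ ≗ liftS σ′
liftS-ren h zero    = refl
liftS-ren h (suc x) = cong (ren suc id) (h x)

liftSSμ-ren : ∀ {k} {τ : SSub k m₂ m₃} {θ : Fin m₁ → Fin m₂} {τ′ : SSub k m₁ m₃} →
              τ ∘ θ ≗ τ′ → liftSSμ τ ∘ liftR θ ≗ liftSSμ τ′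
liftSSμ-ren h zero    = refl
liftSSμ-ren h (suc α) = cong (renEntry id suc) (h α)

msub-ren : ∀ {σ : Fin n₂ → Tm n₃ m₃} {τ : SSub n₃ m₂ m₃} {ρ : Fin n₁ → Fin n₂} {θ : Fin m₁ → Fin m₂}
           {σ′ : Fin n₁ → Tm n₃ m₃} {τ′ : SSub n₃ m₁ m₃} →
           σ ∘ ρ ≗ σ′ → τ ∘ θ ≗ τ′ → ∀ t → msub σ τ (ren ρ θ t) ≡ msub σ′ τ′ t
msubc-renc : ∀ {σ : Fin n₂ → Tm n₃ m₃} {τ : SSub n₃ m₂ m₃} {ρ : Fin n₁ → Fin n₂} {θ : Fin m₁ → Fin m₂}
             {σ′ : Fin n₁ → Tm n₃ m₃} {τ′ : SSub n₃ m₁ m₃} →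
             σ ∘ ρ ≗ σ′ → τ ∘ θ ≗ τ′ → ∀ c → msubc σ τ (renc ρ θ c) ≡ msubc σ′ τ′ c
msub-ren h h′ (var x)      = h x
msub-ren h h′ (lam t)      = cong lam (msub-ren (liftS-ren h) (cong (renEntry suc id) ∘ h′) t)
msub-ren h h′ (app t s)    = cong₂ app (msub-ren h h′ t) (msub-ren h h′ s)
msub-ren h h′ (mu c)       = cong mu (msubc-renc (cong wkμ ∘ h) (liftSSμ-ren h′) c)
msub-ren h h′ ze           = refl
msub-ren h h′ (S t)        = cong S (msub-ren h h′ t)
msub-ren h h′ (nrec r s t) = cong₂ (λ a b → a b) (cong₂ nrec (msub-ren h h′ r) (msub-ren h h′ s)) (msub-ren h h′ t)
msubc-renc h h′ (cmd α t)  = cong₂ _⟨_⟩ (h′ α) (msub-ren h h′ t)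

msubE-renCtx : ∀ {σ : Fin n₂ → Tm n₃ m₃} {τ : SSub n₃ m₂ m₃} {ρ : Fin n₁ → Fin n₂} {θ : Fin m₁ → Fin m₂}
               {σ′ : Fin n₁ → Tm n₃ m₃} {τ′ : SSub n₃ m₁ m₃} →
               σ ∘ ρ ≗ σ′ → τ ∘ θ ≗ τ′ → ∀ E → msubE σ τ (renCtx ρ θ E) ≡ msubE σ′ τ′ E
msubE-renCtx h h′ □             = refl
msubE-renCtx h h′ (E · t)       = cong₂ _·_ (msubE-renCtx h h′ E) (msub-ren h h′ t)
msubE-renCtx h h′ (SC E)        = cong SC (msubE-renCtx h h′ E)
msubE-renCtx h h′ (nrecC r s E) =
  cong₂ (λ a b → a b) (cong₂ nrecC (msub-ren h h′ r) (msub-ren h h′ s)) (msubE-renCtx h h′ E)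

liftS-renAfter : ∀ {σ : Fin n₁ → Tm n₂ m₂} {ρ : Fin n₂ → Fin n₃} {θ : Fin m₂ → Fin m₃} {σ′ : Fin n₁ → Tm n₃ m₃} →
                 ren ρ θ ∘ σ ≗ σ′ → ren (liftR ρ) θ ∘ liftS σ ≗ liftS σ′
liftS-renAfter h zero    = refl
liftS-renAfter {σ = σ} h (suc x) = trans (ren-comm (λ _ → refl) (λ _ → refl) (σ x)) (cong (ren suc id) (h x))

liftSμ-renAfter : ∀ {σ : Fin n₁ → Tm n₂ m₂} {ρ : Fin n₂ → Fin n₃} {θ : Fin m₂ → Fin m₃} {σ′ : Fin n₁ → Tm n₃ m₃} →
                  ren ρ θ ∘ σ ≗ σ′ → ren ρ (liftR θ) ∘ liftSμ σ ≗ liftSμ σ′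
liftSμ-renAfter {σ = σ} h x = trans (wkμ-ren (σ x)) (cong wkμ (h x))

liftSSλ-renAfter : ∀ {τ : SSub n₂ m₁ m₂} {ρ : Fin n₂ → Fin n₃} {θ : Fin m₂ → Fin m₃} {τ′ : SSub n₃ m₁ m₃} →
                   renEntry ρ θ ∘ τ ≗ τ′ → renEntry (liftR ρ) θ ∘ liftSSλ τ ≗ liftSSλ τ′
liftSSλ-renAfter {τ = τ} h α = trans (renEntry-comm (λ _ → refl) (λ _ → refl) (τ α)) (cong (renEntry suc id) (h α))

liftSSμ-renAfter : ∀ {τ : SSub n₂ m₁ m₂} {ρ : Fin n₂ → Fin n₃} {θ : Fin m₂ → Fin m₃} {τ′ : SSub n₃ m₁ m₃} →
                   renEntry ρ θ ∘ τ ≗ τ′ → renEntry ρ (liftR θ) ∘ liftSSμ τ ≗ liftSSμ τ′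
liftSSμ-renAfter h zero = refl
liftSSμ-renAfter {τ = τ} h (suc α) = trans (renEntry-comm (λ _ → refl) (λ _ → refl) (τ α)) (cong (renEntry id suc) (h α))

ren-msub : ∀ {σ : Fin n₁ → Tm n₂ m₂} {τ : SSub n₂ m₁ m₂} {ρ : Fin n₂ → Fin n₃} {θ : Fin m₂ → Fin m₃}
           {σ′ : Fin n₁ → Tm n₃ m₃} {τ′ : SSub n₃ m₁ m₃} →
           ren ρ θ ∘ σ ≗ σ′ → renEntry ρ θ ∘ τ ≗ τ′ → ∀ t → ren ρ θ (msub σ τ t) ≡ msub σ′ τ′ t
renc-msubc : ∀ {σ : Fin n₁ → Tm n₂ m₂} {τ : SSub n₂ m₁ m₂} {ρ : Fin n₂ → Fin n₃} {θ : Fin m₂ → Fin m₃}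
             {σ′ : Fin n₁ → Tm n₃ m₃} {τ′ : SSub n₃ m₁ m₃} →
             ren ρ θ ∘ σ ≗ σ′ → renEntry ρ θ ∘ τ ≗ τ′ → ∀ c → renc ρ θ (msubc σ τ c) ≡ msubc σ′ τ′ c
ren-msub h h′ (var x)      = h x
ren-msub h h′ (lam t)      = cong lam (ren-msub (liftS-renAfter h) (liftSSλ-renAfter h′) t)
ren-msub h h′ (app t s)    = cong₂ app (ren-msub h h′ t) (ren-msub h h′ s)
ren-msub h h′ (mu c)       = cong mu (renc-msubc (liftSμ-renAfter h) (liftSSμ-renAfter h′) c)
ren-msub h h′ ze           = refl
ren-msub h h′ (S t)        = cong S (ren-msub h h′ t)
ren-msub h h′ (nrec r s t) = cong₂ (λ a b → a b) (cong₂ nrec (ren-msub h h′ r) (ren-msub h h′ s)) (ren-msub h h′ t)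
renc-msubc {τ = τ} h h′ (cmd α t) =
  trans (cong (cmd _) (plug-ren (proj₂ (τ α)) _)) (cong₂ _⟨_⟩ (h′ α) (ren-msub h h′ t))

renCtx-msubE : ∀ {σ : Fin n₁ → Tm n₂ m₂} {τ : SSub n₂ m₁ m₂} {ρ : Fin n₂ → Fin n₃} {θ : Fin m₂ → Fin m₃}
               {σ′ : Fin n₁ → Tm n₃ m₃} {τ′ : SSub n₃ m₁ m₃} →
               ren ρ θ ∘ σ ≗ σ′ → renEntry ρ θ ∘ τ ≗ τ′ → ∀ E → renCtx ρ θ (msubE σ τ E) ≡ msubE σ′ τ′ E
renCtx-msubE h h′ □             = refl
renCtx-msubE h h′ (E · t)       = cong₂ _·_ (renCtx-msubE h h′ E) (ren-msub h h′ t)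
renCtx-msubE h h′ (SC E)        = cong SC (renCtx-msubE h h′ E)
renCtx-msubE h h′ (nrecC r s E) =
  cong₂ (λ a b → a b) (cong₂ nrecC (ren-msub h h′ r) (ren-msub h h′ s)) (renCtx-msubE h h′ E)

msub-wkλ : ∀ {σ : Fin n₁ → Tm n₂ m₂} {τ : SSub n₂ m₁ m₂} (t : Tm n₁ m₁) →
           msub (liftS σ) (liftSSλ τ) (ren suc id t) ≡ ren suc id (msub σ τ t)
msub-wkλ t = trans (msub-ren (λ _ → refl) (λ _ → refl) t) (sym (ren-msub (λ _ → refl) (λ _ → refl) t))

msub-wkμ : ∀ {σ : Fin n₁ → Tm n₂ m₂} {τ : SSub n₂ m₁ m₂} (t : Tm n₁ m₁) →
           msub (liftSμ σ) (liftSSμ τ) (wkμ t) ≡ wkμ (msub σ τ t)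
msub-wkμ t = trans (msub-ren (λ _ → refl) (λ _ → refl) t) (sym (ren-msub (λ _ → refl) (λ _ → refl) t))

msubE-wkλ : ∀ {σ : Fin n₁ → Tm n₂ m₂} {τ : SSub n₂ m₁ m₂} (E : Ctx n₁ m₁) →
            msubE (liftS σ) (liftSSλ τ) (renCtx suc id E) ≡ renCtx suc id (msubE σ τ E)
msubE-wkλ E = trans (msubE-renCtx (λ _ → refl) (λ _ → refl) E) (sym (renCtx-msubE (λ _ → refl) (λ _ → refl) E))

msubE-wkμ : ∀ {σ : Fin n₁ → Tm n₂ m₂} {τ : SSub n₂ m₁ m₂} (E : Ctx n₁ m₁) →
            msubE (liftSμ σ) (liftSSμ τ) (renCtx id suc E) ≡ renCtx id suc (msubE σ τ E)
msubE-wkμ E = trans (msubE-renCtx (λ _ → refl) (λ _ → refl) E) (sym (renCtx-msubE (λ _ → refl) (λ _ → refl) E))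

-- The entry (β , E) of a structural substitution followed by the mixed substitution
-- (σ , τ): the command [β]E[q] becomes [β′]E′[E{σ,τ}[q]] where (β′ , E′) = τ β.
thenEntry : (Fin n₂ → Tm n₃ m₃) → SSub n₃ m₂ m₃ → Fin m₂ × Ctx n₂ m₂ → Fin m₃ × Ctx n₃ m₃
thenEntry σ τ p = proj₁ (τ (proj₁ p)) , proj₂ (τ (proj₁ p)) ∘E msubE σ τ (proj₂ p)

liftS-then : ∀ {σ₁ : Fin n₁ → Tm n₂ m₂} {σ₂ : Fin n₂ → Tm n₃ m₃} {τ₂ : SSub n₃ m₂ m₃} {σ : Fin n₁ → Tm n₃ m₃} →
             msub σ₂ τ₂ ∘ σ₁ ≗ σ → msub (liftS σ₂) (liftSSλ τ₂) ∘ liftS σ₁ ≗ liftS σ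
liftS-then h zero = refl
liftS-then {σ₁ = σ₁} h (suc x) = trans (msub-wkλ (σ₁ x)) (cong (ren suc id) (h x))

liftSμ-then : ∀ {σ₁ : Fin n₁ → Tm n₂ m₂} {σ₂ : Fin n₂ → Tm n₃ m₃} {τ₂ : SSub n₃ m₂ m₃} {σ : Fin n₁ → Tm n₃ m₃} →
              msub σ₂ τ₂ ∘ σ₁ ≗ σ → msub (liftSμ σ₂) (liftSSμ τ₂) ∘ liftSμ σ₁ ≗ liftSμ σ
liftSμ-then {σ₁ = σ₁} h x = trans (msub-wkμ (σ₁ x)) (cong wkμ (h x))

liftSSλ-then : ∀ {τ₁ : SSub n₂ m₁ m₂} {σ₂ : Fin n₂ → Tm n₃ m₃} {τ₂ : SSub n₃ m₂ m₃} {τ : SSub n₃ m₁ m₃} →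
               thenEntry σ₂ τ₂ ∘ τ₁ ≗ τ → thenEntry (liftS σ₂) (liftSSλ τ₂) ∘ liftSSλ τ₁ ≗ liftSSλ τ
liftSSλ-then {τ₁ = τ₁} {τ₂ = τ₂} h α =
  trans (cong (proj₁ F ,_) (trans (cong (renCtx suc id (proj₂ F) ∘E_) (msubE-wkλ (proj₂ (τ₁ α))))
                                  (sym (renCtx-∘ (proj₂ F) _))))
        (cong (renEntry suc id) (h α))
  where F = τ₂ (proj₁ (τ₁ α))

liftSSμ-then : ∀ {τ₁ : SSub n₂ m₁ m₂} {σ₂ : Fin n₂ → Tm n₃ m₃} {τ₂ : SSub n₃ m₂ m₃} {τ : SSub n₃ m₁ m₃} →
               thenEntry σ₂ τ₂ ∘ τ₁ ≗ τ → thenEntry (liftSμ σ₂) (liftSSμ τ₂) ∘ liftSSμ τ₁ ≗ liftSSμ τ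
liftSSμ-then h zero = refl
liftSSμ-then {τ₁ = τ₁} {τ₂ = τ₂} h (suc α) =
  trans (cong (suc (proj₁ F) ,_) (trans (cong (renCtx id suc (proj₂ F) ∘E_) (msubE-wkμ (proj₂ (τ₁ α))))
                                        (sym (renCtx-∘ (proj₂ F) _))))
        (cong (renEntry id suc) (h α))
  where F = τ₂ (proj₁ (τ₁ α))

msub-msub : ∀ {σ₁ : Fin n₁ → Tm n₂ m₂} {τ₁ : SSub n₂ m₁ m₂} {σ₂ : Fin n₂ → Tm n₃ m₃} {τ₂ : SSub n₃ m₂ m₃}
            {σ : Fin n₁ → Tm n₃ m₃} {τ : SSub n₃ m₁ m₃} →
            msub σ₂ τ₂ ∘ σ₁ ≗ σ → thenEntry σ₂ τ₂ ∘ τ₁ ≗ τ → ∀ t → msub σ₂ τ₂ (msub σ₁ τ₁ t) ≡ msub σ τ t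
msubc-msubc : ∀ {σ₁ : Fin n₁ → Tm n₂ m₂} {τ₁ : SSub n₂ m₁ m₂} {σ₂ : Fin n₂ → Tm n₃ m₃} {τ₂ : SSub n₃ m₂ m₃}
              {σ : Fin n₁ → Tm n₃ m₃} {τ : SSub n₃ m₁ m₃} →
              msub σ₂ τ₂ ∘ σ₁ ≗ σ → thenEntry σ₂ τ₂ ∘ τ₁ ≗ τ → ∀ c → msubc σ₂ τ₂ (msubc σ₁ τ₁ c) ≡ msubc σ τ c
msub-msub h h′ (var x)      = h x
msub-msub {σ₁ = σ₁} {τ₁} {σ₂} {τ₂} h h′ (lam t) =
  cong lam (msub-msub (liftS-then {σ₁ = σ₁} {σ₂} {τ₂} h) (liftSSλ-then {τ₁ = τ₁} {σ₂} {τ₂} h′) t)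
msub-msub h h′ (app t s)    = cong₂ app (msub-msub h h′ t) (msub-msub h h′ s)
msub-msub {σ₁ = σ₁} {τ₁} {σ₂} {τ₂} h h′ (mu c) =
  cong mu (msubc-msubc (liftSμ-then {σ₁ = σ₁} {σ₂} {τ₂} h) (liftSSμ-then {τ₁ = τ₁} {σ₂} {τ₂} h′) c)
msub-msub h h′ ze           = refl
msub-msub h h′ (S t)        = cong S (msub-msub h h′ t)
msub-msub h h′ (nrec r s t) = cong₂ (λ a b → a b) (cong₂ nrec (msub-msub h h′ r) (msub-msub h h′ s)) (msub-msub h h′ t)
msubc-msubc {τ₁ = τ₁} {τ₂ = τ₂} h h′ (cmd α t) =
  trans (cong (cmd _) (trans (cong (plug E₂) (plug-msub (proj₂ (τ₁ α)) _)) (sym (plug-∘ E₂ _ _))))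
        (cong₂ _⟨_⟩ (h′ α) (msub-msub h h′ t))
  where E₂ = proj₂ (τ₂ (proj₁ (τ₁ α)))

ssRen : (Fin m₁ → Fin m₂) → SSub n m₁ m₂
ssRen θ α = θ α , □

idSS : SSub n m m
idSS = ssRen id

_∷ˢ_ : Tm n₂ m → (Fin n₁ → Tm n₂ m) → Fin (suc n₁) → Tm n₂ m
(r ∷ˢ σ) zero    = r
(r ∷ˢ σ) (suc i) = σ i

ren≡msub : ∀ {ρ : Fin n₁ → Fin n₂} {θ : Fin m₁ → Fin m₂} {σ : Fin n₁ → Tm n₂ m₂} {τ : SSub n₂ m₁ m₂} →
           σ ≗ var ∘ ρ → τ ≗ ssRen θ → ∀ t → ren ρ θ t ≡ msub σ τ t
renc≡msubc : ∀ {ρ : Fin n₁ → Fin n₂} {θ : Fin m₁ → Fin m₂} {σ : Fin n₁ → Tm n₂ m₂} {τ : SSub n₂ m₁ m₂} →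
             σ ≗ var ∘ ρ → τ ≗ ssRen θ → ∀ c → renc ρ θ c ≡ msubc σ τ c
ren≡msub h h′ (var x)      = sym (h x)
ren≡msub {ρ = ρ} {σ = σ} h h′ (lam t) = cong lam (ren≡msub hλ (cong (renEntry suc id) ∘ h′) t)
  where
  hλ : liftS σ ≗ var ∘ liftR ρ
  hλ zero    = refl
  hλ (suc x) = cong (ren suc id) (h x)
ren≡msub h h′ (app t s)    = cong₂ app (ren≡msub h h′ t) (ren≡msub h h′ s)
ren≡msub {θ = θ} {τ = τ} h h′ (mu c) = cong mu (renc≡msubc (cong wkμ ∘ h) hμ c)
  where
  hμ : liftSSμ τ ≗ ssRen (liftR θ)
  hμ zero    = refl
  hμ (suc α) = cong (renEntry id suc) (h′ α)
ren≡msub h h′ ze           = refl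
ren≡msub h h′ (S t)        = cong S (ren≡msub h h′ t)
ren≡msub h h′ (nrec r s t) = cong₂ (λ a b → a b) (cong₂ nrec (ren≡msub h h′ r) (ren≡msub h h′ s)) (ren≡msub h h′ t)
renc≡msubc h h′ (cmd α t)  = cong₂ _⟨_⟩ (sym (h′ α)) (ren≡msub h h′ t)

renCtx≡msubE : ∀ {ρ : Fin n₁ → Fin n₂} {θ : Fin m₁ → Fin m₂} {σ : Fin n₁ → Tm n₂ m₂} {τ : SSub n₂ m₁ m₂} →
               σ ≗ var ∘ ρ → τ ≗ ssRen θ → ∀ E → renCtx ρ θ E ≡ msubE σ τ E
renCtx≡msubE h h′ □             = refl
renCtx≡msubE h h′ (E · t)       = cong₂ _·_ (renCtx≡msubE h h′ E) (ren≡msub h h′ t)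
renCtx≡msubE h h′ (SC E)        = cong SC (renCtx≡msubE h h′ E)
renCtx≡msubE h h′ (nrecC r s E) =
  cong₂ (λ a b → a b) (cong₂ nrecC (ren≡msub h h′ r) (ren≡msub h h′ s)) (renCtx≡msubE h h′ E)

sub≡msub : ∀ {σ σ′ : Fin n₁ → Tm n₂ m} {τ : SSub n₂ m m} → σ ≗ σ′ → τ ≗ idSS → ∀ t → sub σ t ≡ msub σ′ τ t
subc≡msubc : ∀ {σ σ′ : Fin n₁ → Tm n₂ m} {τ : SSub n₂ m m} → σ ≗ σ′ → τ ≗ idSS → ∀ c → subc σ c ≡ msubc σ′ τ c
sub≡msub h h′ (var x)      = h x
sub≡msub {σ = σ} {σ′} h h′ (lam t) = cong lam (sub≡msub hλ (cong (renEntry suc id) ∘ h′) t)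
  where
  hλ : liftS σ ≗ liftS σ′
  hλ zero    = refl
  hλ (suc x) = cong (ren suc id) (h x)
sub≡msub {τ = τ} h h′ (mu c) = cong mu (subc≡msubc (cong wkμ ∘ h) hμ c)
  where
  hμ : liftSSμ τ ≗ idSS
  hμ zero    = refl
  hμ (suc α) = cong (renEntry id suc) (h′ α)
sub≡msub h h′ (app t s)    = cong₂ app (sub≡msub h h′ t) (sub≡msub h h′ s)
sub≡msub h h′ ze           = refl
sub≡msub h h′ (S t)        = cong S (sub≡msub h h′ t)
sub≡msub h h′ (nrec r s t) = cong₂ (λ a b → a b) (cong₂ nrec (sub≡msub h h′ r) (sub≡msub h h′ s)) (sub≡msub h h′ t)
subc≡msubc h h′ (cmd α t)  = cong₂ _⟨_⟩ (sym (h′ α)) (sub≡msub h h′ t)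

ssub≡msub : ∀ {σ : Fin n → Tm n m₂} {τ τ′ : SSub n m₁ m₂} → σ ≗ var → τ ≗ τ′ → ∀ t → ssub τ t ≡ msub σ τ′ t
ssubc≡msubc : ∀ {σ : Fin n → Tm n m₂} {τ τ′ : SSub n m₁ m₂} → σ ≗ var → τ ≗ τ′ → ∀ c → ssubc τ c ≡ msubc σ τ′ c
ssub≡msub h h′ (var x)      = sym (h x)
ssub≡msub {σ = σ} h h′ (lam t) = cong lam (ssub≡msub hλ (cong (renEntry suc id) ∘ h′) t)
  where
  hλ : liftS σ ≗ var
  hλ zero    = refl
  hλ (suc x) = cong (ren suc id) (h x)
ssub≡msub {τ = τ} {τ′} h h′ (mu c) = cong mu (ssubc≡msubc (cong wkμ ∘ h) hμ c)
  where
  hμ : liftSSμ τ ≗ liftSSμ τ′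
  hμ zero    = refl
  hμ (suc α) = cong (renEntry id suc) (h′ α)
ssub≡msub h h′ (app t s)    = cong₂ app (ssub≡msub h h′ t) (ssub≡msub h h′ s)
ssub≡msub h h′ ze           = refl
ssub≡msub h h′ (S t)        = cong S (ssub≡msub h h′ t)
ssub≡msub h h′ (nrec r s t) = cong₂ (λ a b → a b) (cong₂ nrec (ssub≡msub h h′ r) (ssub≡msub h h′ s)) (ssub≡msub h h′ t)
ssubc≡msubc h h′ (cmd α t)  = cong₂ _⟨_⟩ (h′ α) (ssub≡msub h h′ t)

[]≡msub : (t : Tm (suc n) m) (r : Tm n m) → t [ r ] ≡ msub (r ∷ˢ var) idSS t
[]≡msub t r = sub≡msub (λ { zero → refl ; (suc i) → refl }) (λ _ → refl) t

ssubc≡msubc-var : (τ : SSub n m₁ m₂) (c : Cmd n m₁) → ssubc τ c ≡ msubc var τ c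
ssubc≡msubc-var τ = ssubc≡msubc (λ _ → refl) (λ _ → refl)

msub-id : ∀ {σ : Fin n → Tm n m} {τ : SSub n m m} → σ ≗ var → τ ≗ idSS → ∀ t → msub σ τ t ≡ t
msub-id h h′ t = trans (sym (ren≡msub h h′ t)) (ren-id (λ _ → refl) (λ _ → refl) t)

msubc-id : ∀ {σ : Fin n → Tm n m} {τ : SSub n m m} → σ ≗ var → τ ≗ idSS → ∀ c → msubc σ τ c ≡ c
msubc-id h h′ c = trans (sym (renc≡msubc h h′ c)) (renc-id (λ _ → refl) (λ _ → refl) c)

msubE-id : ∀ {σ : Fin n → Tm n m} {τ : SSub n m m} → σ ≗ var → τ ≗ idSS → ∀ E → msubE σ τ E ≡ E
msubE-id h h′ □             = refl
msubE-id h h′ (E · t)       = cong₂ _·_ (msubE-id h h′ E) (msub-id h h′ t)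
msubE-id h h′ (SC E)        = cong SC (msubE-id h h′ E)
msubE-id h h′ (nrecC r s E) = cong₂ (λ a b → a b) (cong₂ nrecC (msub-id h h′ r) (msub-id h h′ s)) (msubE-id h h′ E)

wkE : Ctx n m → Ctx n (suc m)
wkE = renCtx id suc

msub0-wkμ : (E : Ctx n (suc m)) (u : Tm n m) → msub var [0≔0 E ] (wkμ u) ≡ wkμ u
msub0-wkμ E u = trans (msub-ren (λ _ → refl) (λ _ → refl) u) (sym (ren≡msub (λ _ → refl) (λ _ → refl) u))

msub0-wkE : (E : Ctx n (suc m)) (F : Ctx n m) → msubE var [0≔0 E ] (wkE F) ≡ wkE F
msub0-wkE E F = trans (msubE-renCtx (λ _ → refl) (λ _ → refl) F) (sym (renCtx≡msubE (λ _ → refl) (λ _ → refl) F))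

msubγ-wkμ : (γ : Fin m) (u : Tm n m) → msub var [0≔ γ □] (wkμ u) ≡ u
msubγ-wkμ γ u = trans (msub-ren (λ _ → refl) (λ _ → refl) u) (msub-id (λ _ → refl) (λ _ → refl) u)

msubγ-wkE : (γ : Fin m) (F : Ctx n m) → msubE var [0≔ γ □] (wkE F) ≡ F
msubγ-wkE γ F = trans (msubE-renCtx (λ _ → refl) (λ _ → refl) F) (msubE-id (λ _ → refl) (λ _ → refl) F)

ssub0-wkμ : (E : Ctx n (suc m)) (u : Tm n m) → ssub [0≔0 E ] (wkμ u) ≡ wkμ u
ssub0-wkμ E u = trans (ssub≡msub (λ _ → refl) (λ _ → refl) (wkμ u)) (msub0-wkμ E u)

ssubγ-wkμ : (γ : Fin m) (u : Tm n m) → ssub [0≔ γ □] (wkμ u) ≡ u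
ssubγ-wkμ γ u = trans (ssub≡msub (λ _ → refl) (λ _ → refl) (wkμ u)) (msubγ-wkμ γ u)

msub-β : ∀ {σ : Fin n₁ → Tm n₂ m₂} {τ : SSub n₂ m₁ m₂} (p : Tm (suc n₁) m₁) (r : Tm n₁ m₁) →
         msub σ τ (p [ r ]) ≡ msub (liftS σ) (liftSSλ τ) p [ msub σ τ r ]
msub-β {σ = σ} {τ} p r = begin
  msub σ τ (p [ r ])                                   ≡⟨ cong (msub σ τ) ([]≡msub p r) ⟩
  msub σ τ (msub (r ∷ˢ var) idSS p)                    ≡⟨ msub-msub inner-σ inner-τ p ⟩
  msub (r′ ∷ˢ σ) τ p                                   ≡⟨ msub-msub outer-σ outer-τ p ⟨
  msub (r′ ∷ˢ var) idSS (msub (liftS σ) (liftSSλ τ) p) ≡⟨ []≡msub (msub (liftS σ) (liftSSλ τ) p) r′ ⟨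
  msub (liftS σ) (liftSSλ τ) p [ r′ ]                  ∎
  where
  r′ = msub σ τ r
  inner-σ : msub σ τ ∘ (r ∷ˢ var) ≗ r′ ∷ˢ σ
  inner-σ zero    = refl
  inner-σ (suc i) = refl
  inner-τ : thenEntry σ τ ∘ idSS ≗ τ
  inner-τ α = cong (proj₁ (τ α) ,_) (∘E-□ _)
  outer-σ : msub (r′ ∷ˢ var) idSS ∘ liftS σ ≗ r′ ∷ˢ σ
  outer-σ zero    = refl
  outer-σ (suc i) = trans (msub-ren (λ _ → refl) (λ _ → refl) (σ i)) (msub-id (λ _ → refl) (λ _ → refl) (σ i))
  outer-τ : thenEntry (r′ ∷ˢ var) idSS ∘ liftSSλ τ ≗ τ
  outer-τ α = cong (proj₁ (τ α) ,_)
    (trans (msubE-renCtx (λ _ → refl) (λ _ → refl) (proj₂ (τ α))) (msubE-id (λ _ → refl) (λ _ → refl) _))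

_∷ₛ_ : Fin m₂ × Ctx n m₂ → SSub n m₁ m₂ → SSub n (suc m₁) m₂
(p ∷ₛ τ) zero    = p
(p ∷ₛ τ) (suc α) = τ α

ssub0-msub : ∀ {σ : Fin n₁ → Tm n₂ m₂} {τ : SSub n₂ m₁ m₂} (E : Ctx n₂ (suc m₂)) (c : Cmd n₁ (suc m₁)) →
             ssubc [0≔0 E ] (msubc (liftSμ σ) (liftSSμ τ) c) ≡ msubc (liftSμ σ) ((zero , E) ∷ₛ (renEntry id suc ∘ τ)) c
ssub0-msub {σ = σ} {τ} E c =
  trans (ssubc≡msubc-var _ _) (msubc-msubc (λ x → msub0-wkμ E (σ x)) entries c)
  where
  entries : thenEntry var [0≔0 E ] ∘ liftSSμ τ ≗ (zero , E) ∷ₛ (renEntry id suc ∘ τ)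
  entries zero    = cong (zero ,_) (∘E-□ E)
  entries (suc α) = cong (suc (proj₁ (τ α)) ,_) (msub0-wkE E (proj₂ (τ α)))

msub-ssub0 : ∀ {σ : Fin n₁ → Tm n₂ m₂} {τ : SSub n₂ m₁ m₂} (E : Ctx n₁ (suc m₁)) {E′ : Ctx n₂ (suc m₂)} →
             msubE (liftSμ σ) (liftSSμ τ) E ≡ E′ → ∀ c →
             msubc (liftSμ σ) (liftSSμ τ) (ssubc [0≔0 E ] c) ≡ ssubc [0≔0 E′ ] (msubc (liftSμ σ) (liftSSμ τ) c)
msub-ssub0 {σ = σ} {τ} E {E′} E↦E′ c = begin
  msubc (liftSμ σ) (liftSSμ τ) (ssubc [0≔0 E ] c)        ≡⟨ cong (msubc _ _) (ssubc≡msubc-var _ c) ⟩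
  msubc (liftSμ σ) (liftSSμ τ) (msubc var [0≔0 E ] c)    ≡⟨ msubc-msubc (λ _ → refl) entries c ⟩
  msubc (liftSμ σ) ((zero , E′) ∷ₛ (renEntry id suc ∘ τ)) c ≡⟨ ssub0-msub E′ c ⟨
  ssubc [0≔0 E′ ] (msubc (liftSμ σ) (liftSSμ τ) c)       ∎
  where
  entries : thenEntry (liftSμ σ) (liftSSμ τ) ∘ [0≔0 E ] ≗ (zero , E′) ∷ₛ (renEntry id suc ∘ τ)
  entries zero    = cong (zero ,_) E↦E′
  entries (suc α) = cong (suc (proj₁ (τ α)) ,_) (∘E-□ _)

msub-ssubγ : ∀ {σ : Fin n₁ → Tm n₂ m₂} {τ : SSub n₂ m₁ m₂} (α : Fin m₁) (c : Cmd n₁ (suc m₁)) →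
             msubc σ τ (ssubc [0≔ α □] c) ≡
             ssubc [0≔ proj₁ (τ α) □] (ssubc [0≔0 wkE (proj₂ (τ α)) ] (msubc (liftSμ σ) (liftSSμ τ) c))
msub-ssubγ {σ = σ} {τ} α c = begin
  msubc σ τ (ssubc [0≔ α □] c)                 ≡⟨ cong (msubc σ τ) (ssubc≡msubc-var _ c) ⟩
  msubc σ τ (msubc var [0≔ α □] c)             ≡⟨ msubc-msubc (λ _ → refl) entriesˡ c ⟩
  msubc σ (τ α ∷ₛ τ) c                         ≡⟨ msubc-msubc (λ x → msubγ-wkμ δ (σ x)) entriesʳ c ⟨
  msubc var [0≔ δ □] (msubc (liftSμ σ) ((zero , wkE F) ∷ₛ (renEntry id suc ∘ τ)) c)
    ≡⟨ cong (msubc var [0≔ δ □]) (ssub0-msub (wkE F) c) ⟨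
  msubc var [0≔ δ □] (ssubc [0≔0 wkE F ] (msubc (liftSμ σ) (liftSSμ τ) c))
    ≡⟨ ssubc≡msubc-var _ _ ⟨
  ssubc [0≔ δ □] (ssubc [0≔0 wkE F ] (msubc (liftSμ σ) (liftSSμ τ) c)) ∎
  where
  δ = proj₁ (τ α)
  F = proj₂ (τ α)
  entriesˡ : thenEntry σ τ ∘ [0≔ α □] ≗ τ α ∷ₛ τ
  entriesˡ zero    = cong (δ ,_) (∘E-□ _)
  entriesˡ (suc γ) = cong (proj₁ (τ γ) ,_) (∘E-□ _)
  entriesʳ : thenEntry var [0≔ δ □] ∘ ((zero , wkE F) ∷ₛ (renEntry id suc ∘ τ)) ≗ τ α ∷ₛ τ
  entriesʳ zero    = cong (δ ,_) (msubγ-wkE δ F)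
  entriesʳ (suc γ) = cong (proj₁ (τ γ) ,_) (msubγ-wkE δ (proj₂ (τ γ)))

ssub0-ssub0 : (F : Ctx n (suc m)) (X : Ctx n m) (d : Cmd n (suc m)) →
              ssubc [0≔0 F ] (ssubc [0≔0 wkE X ] d) ≡ ssubc [0≔0 F ∘E wkE X ] d
ssub0-ssub0 F X d = begin
  ssubc [0≔0 F ] (ssubc [0≔0 wkE X ] d)         ≡⟨ cong₂ ssubc refl (ssubc≡msubc-var _ d) ⟩
  ssubc [0≔0 F ] (msubc var [0≔0 wkE X ] d)     ≡⟨ ssubc≡msubc-var _ _ ⟩
  msubc var [0≔0 F ] (msubc var [0≔0 wkE X ] d) ≡⟨ msubc-msubc (λ _ → refl) entries d ⟩
  msubc var [0≔0 F ∘E wkE X ] d                 ≡⟨ ssubc≡msubc-var _ d ⟨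
  ssubc [0≔0 F ∘E wkE X ] d                     ∎
  where
  entries : thenEntry var [0≔0 F ] ∘ [0≔0 wkE X ] ≗ [0≔0 F ∘E wkE X ]
  entries zero    = cong (λ z → zero , F ∘E z) (msub0-wkE F X)
  entries (suc γ) = refl

ssub0-□ : (d : Cmd n (suc m)) → ssubc [0≔0 □ ] d ≡ d
ssub0-□ d = trans (ssubc≡msubc-var _ d) (msubc-id (λ _ → refl) (λ { zero → refl ; (suc _) → refl }) d)

ssubγ-merge : (d : Cmd n (suc m)) → ssubc [0≔ zero □] (renc id (liftR suc) d) ≡ d
ssubγ-merge d = begin
  ssubc [0≔ zero □] (renc id (liftR suc) d)     ≡⟨ ssubc≡msubc-var _ _ ⟩
  msubc var [0≔ zero □] (renc id (liftR suc) d) ≡⟨ msubc-renc (λ _ → refl) (λ { zero → refl ; (suc _) → refl }) d ⟩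
  msubc var idSS d                              ≡⟨ msubc-id (λ _ → refl) (λ _ → refl) d ⟩
  d                                             ∎

ren-β : ∀ {ρ : Fin n₁ → Fin n₂} {θ : Fin m₁ → Fin m₂} (p : Tm (suc n₁) m₁) (r : Tm n₁ m₁) →
        ren ρ θ (p [ r ]) ≡ ren (liftR ρ) θ p [ ren ρ θ r ]
ren-β {ρ = ρ} {θ} p r = begin
  ren ρ θ (p [ r ])                              ≡⟨ ren≡msub (λ _ → refl) (λ _ → refl) _ ⟩
  msub (var ∘ ρ) (ssRen θ) (p [ r ])             ≡⟨ msub-β p r ⟩
  msub (liftS (var ∘ ρ)) (ssRen θ) p [ msub (var ∘ ρ) (ssRen θ) r ]
    ≡⟨ cong₂ _[_] (ren≡msub liftλ (λ _ → refl) p) (ren≡msub (λ _ → refl) (λ _ → refl) r) ⟨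
  ren (liftR ρ) θ p [ ren ρ θ r ]                ∎
  where
  liftλ : liftS (var {m = m₂} ∘ ρ) ≗ var ∘ liftR ρ
  liftλ zero    = refl
  liftλ (suc x) = refl

liftSSμ-ssRen : ∀ {θ : Fin m₁ → Fin m₂} → liftSSμ {n = n} (ssRen θ) ≗ ssRen (liftR θ)
liftSSμ-ssRen zero    = refl
liftSSμ-ssRen (suc α) = refl

ren-ssub0 : ∀ {ρ : Fin n₁ → Fin n₂} {θ : Fin m₁ → Fin m₂} (E : Ctx n₁ (suc m₁)) {E′ : Ctx n₂ (suc m₂)} →
            renCtx ρ (liftR θ) E ≡ E′ → ∀ c →
            renc ρ (liftR θ) (ssubc [0≔0 E ] c) ≡ ssubc [0≔0 E′ ] (renc ρ (liftR θ) c)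
ren-ssub0 E E↦E′ c = begin
  renc _ _ (ssubc [0≔0 E ] c)               ≡⟨ renc≡msubc (λ _ → refl) liftSSμ-ssRen _ ⟩
  msubc _ _ (ssubc [0≔0 E ] c)              ≡⟨ msub-ssub0 E (trans (sym (renCtx≡msubE (λ _ → refl) liftSSμ-ssRen E)) E↦E′) c ⟩
  ssubc [0≔0 _ ] (msubc _ _ c)              ≡⟨ cong (ssubc _) (renc≡msubc (λ _ → refl) liftSSμ-ssRen c) ⟨
  ssubc [0≔0 _ ] (renc _ _ c)               ∎

ren-ssubγ : ∀ {ρ : Fin n₁ → Fin n₂} {θ : Fin m₁ → Fin m₂} (α : Fin m₁) (c : Cmd n₁ (suc m₁)) →
            renc ρ θ (ssubc [0≔ α □] c) ≡ ssubc [0≔ θ α □] (renc ρ (liftR θ) c)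
ren-ssubγ {θ = θ} α c = begin
  renc _ θ (ssubc [0≔ α □] c)                                       ≡⟨ renc≡msubc (λ _ → refl) (λ _ → refl) _ ⟩
  msubc _ _ (ssubc [0≔ α □] c)                                      ≡⟨ msub-ssubγ α c ⟩
  ssubc [0≔ θ α □] (ssubc [0≔0 □ ] (msubc _ (liftSSμ (ssRen θ)) c)) ≡⟨ cong (ssubc _) (ssub0-□ _) ⟩
  ssubc [0≔ θ α □] (msubc _ (liftSSμ (ssRen θ)) c)                  ≡⟨ cong (ssubc _) (renc≡msubc (λ _ → refl) liftSSμ-ssRen c) ⟨
  ssubc [0≔ θ α □] (renc _ (liftR θ) c)                             ∎

-- Parallel reduction: contracts simultaneously any set of redexes except μη, which
-- is treated separately (see _→η_).  A redex rule first reduces the head to redex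
-- form (t ⇒ lam p, t ⇒ mu c, t ⇒ S (num k), ...), so that the development of a term
-- is reachable in one step (par-triangle).  Results are given by equations to keep
-- the indices of the conclusions patterns.
infix 4 _⇒_ _⇒c_ _⇒E_ _⇒SS_

data _⇒_ : Tm n m → Tm n m → Set
data _⇒c_ : Cmd n m → Cmd n m → Set

data _⇒_ where
  pvar   : ∀ {x : Fin n} → var {n} {m} x ⇒ var x
  plam   : ∀ {t t′ : Tm (suc n) m} → t ⇒ t′ → lam t ⇒ lam t′
  papp   : ∀ {t t′ s s′ : Tm n m} → t ⇒ t′ → s ⇒ s′ → app t s ⇒ app t′ s′
  pβ     : ∀ {t s s′ u : Tm n m} {p : Tm (suc n) m} → t ⇒ lam p → s ⇒ s′ → u ≡ p [ s′ ] → app t s ⇒ u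
  pμapp  : ∀ {t s s′ u : Tm n m} {c : Cmd n (suc m)} → t ⇒ mu c → s ⇒ s′ →
           u ≡ mu (ssubc [0≔0 □ · wkμ s′ ] c) → app t s ⇒ u
  pmu    : ∀ {c c′ : Cmd n (suc m)} → c ⇒c c′ → mu c ⇒ mu c′
  pze    : ze {n} {m} ⇒ ze
  pS     : ∀ {t t′ : Tm n m} → t ⇒ t′ → S t ⇒ S t′
  pμS    : ∀ {t u : Tm n m} {c : Cmd n (suc m)} → t ⇒ mu c → u ≡ mu (ssubc [0≔0 SC □ ] c) → S t ⇒ u
  pnrec  : ∀ {r r′ s s′ t t′ : Tm n m} → r ⇒ r′ → s ⇒ s′ → t ⇒ t′ → nrec r s t ⇒ nrec r′ s′ t′
  pnrec0 : ∀ {r r′ s t : Tm n m} → r ⇒ r′ → t ⇒ ze → nrec r s t ⇒ r′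
  pnrecS : ∀ {r r′ s s′ t u : Tm n m} (k : ℕ) → r ⇒ r′ → s ⇒ s′ → t ⇒ S (num k) →
           u ≡ app (app s′ (num k)) (nrec r′ s′ (num k)) → nrec r s t ⇒ u
  pnrecμ : ∀ {r r′ s s′ t u : Tm n m} {c : Cmd n (suc m)} → r ⇒ r′ → s ⇒ s′ → t ⇒ mu c →
           u ≡ mu (ssubc [0≔0 nrecC (wkμ r′) (wkμ s′) □ ] c) → nrec r s t ⇒ u

data _⇒c_ where
  pcmd  : ∀ {α : Fin m} {t t′ : Tm n m} → t ⇒ t′ → cmd α t ⇒c cmd α t′
  pcmdμ : ∀ {α : Fin m} {t : Tm n m} {c : Cmd n (suc m)} {d : Cmd n m} → t ⇒ mu c →
          d ≡ ssubc [0≔ α □] c → cmd α t ⇒c d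

data _⇒E_ {n m : ℕ} : Ctx n m → Ctx n m → Set where
  p□     : □ ⇒E □
  p·     : ∀ {E E′ t t′} → E ⇒E E′ → t ⇒ t′ → E · t ⇒E E′ · t′
  pSC    : ∀ {E E′} → E ⇒E E′ → SC E ⇒E SC E′
  pnrecC : ∀ {r r′ s s′ E E′} → r ⇒ r′ → s ⇒ s′ → E ⇒E E′ → nrecC r s E ⇒E nrecC r′ s′ E′

par-refl : (t : Tm n m) → t ⇒ t
parc-refl : (c : Cmd n m) → c ⇒c c
par-refl (var x)      = pvar
par-refl (lam t)      = plam (par-refl t)
par-refl (app t s)    = papp (par-refl t) (par-refl s)
par-refl (mu c)       = pmu (parc-refl c)
par-refl ze           = pze
par-refl (S t)        = pS (par-refl t)
par-refl (nrec r s t) = pnrec (par-refl r) (par-refl s) (par-refl t)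
parc-refl (cmd α t)   = pcmd (par-refl t)

plug-par : ∀ {E E′ : Ctx n m} {q q′} → E ⇒E E′ → q ⇒ q′ → plug E q ⇒ plug E′ q′
plug-par p□               q⇒q′ = q⇒q′
plug-par (p· E⇒E′ t⇒t′)   q⇒q′ = papp (plug-par E⇒E′ q⇒q′) t⇒t′
plug-par (pSC E⇒E′)       q⇒q′ = pS (plug-par E⇒E′ q⇒q′)
plug-par (pnrecC r⇒ s⇒ E⇒E′) q⇒q′ = pnrec r⇒ s⇒ (plug-par E⇒E′ q⇒q′)

-- A context around a term reducing to μα.d is absorbed into the binder:
-- E[q] ⇒ μα.d[α ≔ α E′].  This is the iterated form of the μ-redex rules.
plug-μ : ∀ {E E′ : Ctx n m} {q d} → E ⇒E E′ → q ⇒ mu d → plug E q ⇒ mu (ssubc [0≔0 wkE E′ ] d)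
plug-μ {q = q} {d = d} p□ q⇒ = subst (q ⇒_) (cong mu (sym (ssub0-□ d))) q⇒
plug-μ {E′ = E′ · t′} {d = d} (p· E⇒ t⇒) q⇒ =
  pμapp (plug-μ E⇒ q⇒) t⇒ (cong mu (sym (ssub0-ssub0 (□ · wkμ t′) E′ d)))
plug-μ {E′ = SC E′} {d = d} (pSC E⇒) q⇒ =
  pμS (plug-μ E⇒ q⇒) (cong mu (sym (ssub0-ssub0 (SC □) E′ d)))
plug-μ {E′ = nrecC r′ s′ E′} {d = d} (pnrecC r⇒ s⇒ E⇒) q⇒ =
  pnrecμ r⇒ s⇒ (plug-μ E⇒ q⇒) (cong mu (sym (ssub0-ssub0 (nrecC (wkμ r′) (wkμ s′) □) E′ d)))

ren-num : ∀ {ρ : Fin n₁ → Fin n₂} {θ : Fin m₁ → Fin m₂} k → ren ρ θ (num k) ≡ num k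
ren-num zero    = refl
ren-num (suc k) = cong S (ren-num k)

msub-num : ∀ {σ : Fin n₁ → Tm n₂ m₂} {τ : SSub n₂ m₁ m₂} k → msub σ τ (num k) ≡ num k
msub-num zero    = refl
msub-num (suc k) = cong S (msub-num k)

par-ren : ∀ {ρ : Fin n₁ → Fin n₂} {θ : Fin m₁ → Fin m₂} {t t′} → t ⇒ t′ → ren ρ θ t ⇒ ren ρ θ t′
parc-ren : ∀ {ρ : Fin n₁ → Fin n₂} {θ : Fin m₁ → Fin m₂} {c c′} → c ⇒c c′ → renc ρ θ c ⇒c renc ρ θ c′
par-ren pvar          = pvar
par-ren (plam d)      = plam (par-ren d)
par-ren (papp d e)    = papp (par-ren d) (par-ren e)
par-ren (pβ {s′ = s′} {p = p} d e refl) = pβ (par-ren d) (par-ren e) (ren-β p s′)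
par-ren (pμapp {s′ = s′} {c = c} d e refl) =
  pμapp (par-ren d) (par-ren e) (cong mu (ren-ssub0 _ (cong (□ ·_) (wkμ-ren s′)) c))
par-ren (pmu d)       = pmu (parc-ren d)
par-ren pze           = pze
par-ren (pS d)        = pS (par-ren d)
par-ren (pμS {c = c} d refl) = pμS (par-ren d) (cong mu (ren-ssub0 (SC □) refl c))
par-ren (pnrec d e f) = pnrec (par-ren d) (par-ren e) (par-ren f)
par-ren (pnrec0 d e)  = pnrec0 (par-ren d) (par-ren e)
par-ren {ρ = ρ} {θ} (pnrecS {r′ = r′} {s′ = s′} k d e f refl) =
  pnrecS k (par-ren d) (par-ren e) (subst (λ z → _ ⇒ S z) (ren-num k) (par-ren f))
    (cong₂ (λ a b → app (app (ren ρ θ s′) a) (nrec (ren ρ θ r′) (ren ρ θ s′) b)) (ren-num k) (ren-num k))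
par-ren (pnrecμ {r′ = r′} {s′ = s′} {c = c} d e f refl) =
  pnrecμ (par-ren d) (par-ren e) (par-ren f)
    (cong mu (ren-ssub0 _ (cong₂ (λ a b → nrecC a b □) (wkμ-ren r′) (wkμ-ren s′)) c))
parc-ren (pcmd d) = pcmd (par-ren d)
parc-ren (pcmdμ {α = α} {c = c} d refl) = pcmdμ (par-ren d) (ren-ssubγ α c)

parE-ren : ∀ {ρ : Fin n₁ → Fin n₂} {θ : Fin m₁ → Fin m₂} {E E′} → E ⇒E E′ → renCtx ρ θ E ⇒E renCtx ρ θ E′
parE-ren p□               = p□
parE-ren (p· E⇒ t⇒)       = p· (parE-ren E⇒) (par-ren t⇒)
parE-ren (pSC E⇒)         = pSC (parE-ren E⇒)
parE-ren (pnrecC r⇒ s⇒ E⇒) = pnrecC (par-ren r⇒) (par-ren s⇒) (parE-ren E⇒)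

_⇒SS_ : SSub n₂ m₁ m₂ → SSub n₂ m₁ m₂ → Set
τ ⇒SS τ′ = ∀ α → (proj₁ (τ α) ≡ proj₁ (τ′ α)) × (proj₂ (τ α) ⇒E proj₂ (τ′ α))

par-msub : ∀ {σ σ′ : Fin n₁ → Tm n₂ m₂} {τ τ′ : SSub n₂ m₁ m₂} {t t′} → t ⇒ t′ →
           (∀ x → σ x ⇒ σ′ x) → τ ⇒SS τ′ → msub σ τ t ⇒ msub σ′ τ′ t′
parc-msub : ∀ {σ σ′ : Fin n₁ → Tm n₂ m₂} {τ τ′ : SSub n₂ m₁ m₂} {c c′} → c ⇒c c′ →
            (∀ x → σ x ⇒ σ′ x) → τ ⇒SS τ′ → msubc σ τ c ⇒c msubc σ′ τ′ c′
par-msub pvar σ⇒ τ⇒ = σ⇒ _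
par-msub {σ = σ} {σ′} (plam d) σ⇒ τ⇒ = plam (par-msub d hλ (λ α → proj₁ (τ⇒ α) , parE-ren (proj₂ (τ⇒ α))))
  where
  hλ : ∀ x → liftS σ x ⇒ liftS σ′ x
  hλ zero    = pvar
  hλ (suc x) = par-ren (σ⇒ x)
par-msub (papp d e) σ⇒ τ⇒ = papp (par-msub d σ⇒ τ⇒) (par-msub e σ⇒ τ⇒)
par-msub (pβ {s′ = s′} {p = p} d e refl) σ⇒ τ⇒ = pβ (par-msub d σ⇒ τ⇒) (par-msub e σ⇒ τ⇒) (msub-β p s′)
par-msub (pμapp {s′ = s′} {c = c} d e refl) σ⇒ τ⇒ =
  pμapp (par-msub d σ⇒ τ⇒) (par-msub e σ⇒ τ⇒) (cong mu (msub-ssub0 (□ · wkμ s′) (cong (□ ·_) (msub-wkμ s′)) c))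
par-msub {τ = τ} {τ′} (pmu d) σ⇒ τ⇒ = pmu (parc-msub d (par-ren ∘ σ⇒) hμ)
  where
  hμ : liftSSμ τ ⇒SS liftSSμ τ′
  hμ zero    = refl , p□
  hμ (suc α) = cong suc (proj₁ (τ⇒ α)) , parE-ren (proj₂ (τ⇒ α))
par-msub pze σ⇒ τ⇒ = pze
par-msub (pS d) σ⇒ τ⇒ = pS (par-msub d σ⇒ τ⇒)
par-msub (pμS {c = c} d refl) σ⇒ τ⇒ = pμS (par-msub d σ⇒ τ⇒) (cong mu (msub-ssub0 (SC □) refl c))
par-msub (pnrec d e f) σ⇒ τ⇒ = pnrec (par-msub d σ⇒ τ⇒) (par-msub e σ⇒ τ⇒) (par-msub f σ⇒ τ⇒)
par-msub (pnrec0 d e) σ⇒ τ⇒ = pnrec0 (par-msub d σ⇒ τ⇒) (par-msub e σ⇒ τ⇒)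
par-msub {σ′ = σ′} {τ′ = τ′} (pnrecS {r′ = r′} {s′ = s′} k d e f refl) σ⇒ τ⇒ =
  pnrecS k (par-msub d σ⇒ τ⇒) (par-msub e σ⇒ τ⇒) (subst (λ z → _ ⇒ S z) (msub-num k) (par-msub f σ⇒ τ⇒))
    (cong₂ (λ a b → app (app (msub σ′ τ′ s′) a) (nrec (msub σ′ τ′ r′) (msub σ′ τ′ s′) b)) (msub-num k) (msub-num k))
par-msub (pnrecμ {r′ = r′} {s′ = s′} {c = c} d e f refl) σ⇒ τ⇒ =
  pnrecμ (par-msub d σ⇒ τ⇒) (par-msub e σ⇒ τ⇒) (par-msub f σ⇒ τ⇒)
    (cong mu (msub-ssub0 (nrecC (wkμ r′) (wkμ s′) □) (cong₂ (λ a b → nrecC a b □) (msub-wkμ r′) (msub-wkμ s′)) c))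
parc-msub {τ = τ} (pcmd {α = α} d) σ⇒ τ⇒ =
  subst (λ γ → τ α ⟨ _ ⟩ ⇒c cmd γ _) (proj₁ (τ⇒ α)) (pcmd (plug-par (proj₂ (τ⇒ α)) (par-msub d σ⇒ τ⇒)))
parc-msub {τ = τ} (pcmdμ {α = α} {c = c} d refl) σ⇒ τ⇒ =
  subst (λ γ → cmd γ _ ⇒c _) (sym (proj₁ (τ⇒ α))) (pcmdμ (plug-μ (proj₂ (τ⇒ α)) (par-msub d σ⇒ τ⇒)) (msub-ssubγ α c))

par-[] : ∀ {p p′ : Tm (suc n) m} {s s′} → p ⇒ p′ → s ⇒ s′ → p [ s ] ⇒ p′ [ s′ ]
par-[] {p = p} {p′} {s} {s′} p⇒ s⇒ =
  subst₂ _⇒_ (sym ([]≡msub p s)) (sym ([]≡msub p′ s′)) (par-msub p⇒ (λ { zero → s⇒ ; (suc i) → pvar }) (λ _ → refl , p□))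

parc-ssub : ∀ {τ τ′ : SSub n m₁ m₂} {c c′} → c ⇒c c′ → τ ⇒SS τ′ → ssubc τ c ⇒c ssubc τ′ c′
parc-ssub {τ = τ} {τ′} {c} {c′} c⇒ τ⇒ =
  subst₂ _⇒c_ (sym (ssubc≡msubc-var τ c)) (sym (ssubc≡msubc-var τ′ c′)) (parc-msub c⇒ (λ _ → pvar) τ⇒)

ssub0-par : ∀ {E E′ : Ctx n (suc m)} → E ⇒E E′ → [0≔0 E ] ⇒SS [0≔0 E′ ]
ssub0-par E⇒ zero    = refl , E⇒
ssub0-par E⇒ (suc α) = refl , p□

ssubγ-par : ∀ {α : Fin m} → [0≔_□] {n} α ⇒SS [0≔ α □]
ssubγ-par zero    = refl , p□
ssubγ-par (suc α) = refl , p□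

-- Recognising numerals, to decide whether nrec r s (S u) is a redex.
numeral? : Tm n m → Maybe ℕ
numeral? ze           = just zero
numeral? (S u)        = Maybe.map suc (numeral? u)
numeral? (var x)      = nothing
numeral? (lam t)      = nothing
numeral? (app t s)    = nothing
numeral? (mu c)       = nothing
numeral? (nrec r s t) = nothing

numeral?-num : ∀ k → numeral? {n} {m} (num k) ≡ just k
numeral?-num zero    = refl
numeral?-num (suc k) = cong (Maybe.map suc) (numeral?-num k)

numeral?-just : ∀ (u : Tm n m) k → numeral? u ≡ just k → u ≡ num k
numeral?-just ze .zero refl = refl
numeral?-just (S u) k eq with numeral? u in e
numeral?-just (S u) .(suc j) refl | just j = cong S (numeral?-just u j e)

num≢mu : ∀ k {c : Cmd n (suc m)} → mu c ≡ num k → ⊥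
num≢mu zero    ()
num≢mu (suc k) ()

num-inv : ∀ k {u : Tm n m} → num k ⇒ u → u ≡ num k
num-inv zero    pze          = refl
num-inv (suc k) (pS d)       = cong S (num-inv k d)
num-inv (suc k) (pμS d refl) = ⊥-elim (num≢mu k (num-inv k d))

-- The complete development dev t contracts every redex of t except μη, bottom-up.
-- The helpers contract the outer redex when the developed subterms form one.
dev-app : Tm n m → Tm n m → Tm n m
dev-app (lam p)      s = p [ s ]
dev-app (mu c)       s = mu (ssubc [0≔0 □ · wkμ s ] c)
dev-app (var x)      s = app (var x) s
dev-app (app t u)    s = app (app t u) s
dev-app ze           s = app ze s
dev-app (S t)        s = app (S t) s
dev-app (nrec a b t) s = app (nrec a b t) s

dev-S : Tm n m → Tm n m
dev-S (mu c)       = mu (ssubc [0≔0 SC □ ] c)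
dev-S (var x)      = S (var x)
dev-S (lam t)      = S (lam t)
dev-S (app t u)    = S (app t u)
dev-S ze           = S ze
dev-S (S t)        = S (S t)
dev-S (nrec a b t) = S (nrec a b t)

dev-nrecS : Tm n m → Tm n m → Tm n m → Maybe ℕ → Tm n m
dev-nrecS r s u (just k) = app (app s (num k)) (nrec r s (num k))
dev-nrecS r s u nothing  = nrec r s (S u)

dev-nrec : Tm n m → Tm n m → Tm n m → Tm n m
dev-nrec r s ze           = r
dev-nrec r s (S u)        = dev-nrecS r s u (numeral? u)
dev-nrec r s (mu c)       = mu (ssubc [0≔0 nrecC (wkμ r) (wkμ s) □ ] c)
dev-nrec r s (var x)      = nrec r s (var x)
dev-nrec r s (lam t)      = nrec r s (lam t)
dev-nrec r s (app t u)    = nrec r s (app t u)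
dev-nrec r s (nrec a b t) = nrec r s (nrec a b t)

dev-cmd : Fin m → Tm n m → Cmd n m
dev-cmd α (mu c)       = ssubc [0≔ α □] c
dev-cmd α (var x)      = cmd α (var x)
dev-cmd α (lam t)      = cmd α (lam t)
dev-cmd α (app t u)    = cmd α (app t u)
dev-cmd α ze           = cmd α ze
dev-cmd α (S t)        = cmd α (S t)
dev-cmd α (nrec a b t) = cmd α (nrec a b t)

dev  : Tm n m → Tm n m
devc : Cmd n m → Cmd n m
dev (var x)      = var x
dev (lam t)      = lam (dev t)
dev (app t s)    = dev-app (dev t) (dev s)
dev (mu c)       = mu (devc c)
dev ze           = ze
dev (S t)        = dev-S (dev t)
dev (nrec r s t) = dev-nrec (dev r) (dev s) (dev t)
devc (cmd α t)   = dev-cmd α (dev t)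

dev-nrec-S-num : (r s : Tm n m) (k : ℕ) → dev-nrec r s (S (num k)) ≡ app (app s (num k)) (nrec r s (num k))
dev-nrec-S-num r s k = cong (dev-nrecS r s (num k)) (numeral?-num k)

dev-app-par : ∀ {t s s′ : Tm n m} t′ → t ⇒ t′ → s ⇒ s′ → app t s ⇒ dev-app t′ s′
dev-app-par (lam p)      t⇒ s⇒ = pβ t⇒ s⇒ refl
dev-app-par (mu c)       t⇒ s⇒ = pμapp t⇒ s⇒ refl
dev-app-par (var x)      t⇒ s⇒ = papp t⇒ s⇒
dev-app-par (app _ _)    t⇒ s⇒ = papp t⇒ s⇒
dev-app-par ze           t⇒ s⇒ = papp t⇒ s⇒
dev-app-par (S _)        t⇒ s⇒ = papp t⇒ s⇒
dev-app-par (nrec _ _ _) t⇒ s⇒ = papp t⇒ s⇒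

dev-S-par : ∀ {t : Tm n m} t′ → t ⇒ t′ → S t ⇒ dev-S t′
dev-S-par (mu c)       t⇒ = pμS t⇒ refl
dev-S-par (var x)      t⇒ = pS t⇒
dev-S-par (lam _)      t⇒ = pS t⇒
dev-S-par (app _ _)    t⇒ = pS t⇒
dev-S-par ze           t⇒ = pS t⇒
dev-S-par (S _)        t⇒ = pS t⇒
dev-S-par (nrec _ _ _) t⇒ = pS t⇒

dev-nrec-par : ∀ {r s t r′ s′ : Tm n m} t′ → r ⇒ r′ → s ⇒ s′ → t ⇒ t′ → nrec r s t ⇒ dev-nrec r′ s′ t′
dev-nrec-par ze           r⇒ s⇒ t⇒ = pnrec0 r⇒ t⇒
dev-nrec-par (S u)        r⇒ s⇒ t⇒ with numeral? u in e
... | just k  = pnrecS k r⇒ s⇒ (subst (λ z → _ ⇒ S z) (numeral?-just u k e) t⇒) refl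
... | nothing = pnrec r⇒ s⇒ t⇒
dev-nrec-par (mu c)       r⇒ s⇒ t⇒ = pnrecμ r⇒ s⇒ t⇒ refl
dev-nrec-par (var x)      r⇒ s⇒ t⇒ = pnrec r⇒ s⇒ t⇒
dev-nrec-par (lam _)      r⇒ s⇒ t⇒ = pnrec r⇒ s⇒ t⇒
dev-nrec-par (app _ _)    r⇒ s⇒ t⇒ = pnrec r⇒ s⇒ t⇒
dev-nrec-par (nrec _ _ _) r⇒ s⇒ t⇒ = pnrec r⇒ s⇒ t⇒

dev-cmd-par : ∀ {α : Fin m} {t : Tm n m} t′ → t ⇒ t′ → cmd α t ⇒c dev-cmd α t′
dev-cmd-par (mu c)       t⇒ = pcmdμ t⇒ refl
dev-cmd-par (var x)      t⇒ = pcmd t⇒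
dev-cmd-par (lam _)      t⇒ = pcmd t⇒
dev-cmd-par (app _ _)    t⇒ = pcmd t⇒
dev-cmd-par ze           t⇒ = pcmd t⇒
dev-cmd-par (S _)        t⇒ = pcmd t⇒
dev-cmd-par (nrec _ _ _) t⇒ = pcmd t⇒

par-triangle  : ∀ {t t′ : Tm n m} → t ⇒ t′ → t′ ⇒ dev t
parc-triangle : ∀ {c c′ : Cmd n m} → c ⇒c c′ → c′ ⇒c devc c
par-triangle pvar = pvar
par-triangle (plam d) = plam (par-triangle d)
par-triangle (papp {t = t} d e) = dev-app-par (dev t) (par-triangle d) (par-triangle e)
par-triangle (pβ {t = t} d e refl) with dev t | par-triangle d
... | .(lam _) | plam d′ = par-[] d′ (par-triangle e)
par-triangle (pμapp {t = t} d e refl) with dev t | par-triangle d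
... | .(mu _) | pmu d′ = pmu (parc-ssub d′ (ssub0-par (p· p□ (par-ren (par-triangle e)))))
par-triangle (pmu d) = pmu (parc-triangle d)
par-triangle pze = pze
par-triangle (pS {t = t} d) = dev-S-par (dev t) (par-triangle d)
par-triangle (pμS {t = t} d refl) with dev t | par-triangle d
... | .(mu _) | pmu d′ = pmu (parc-ssub d′ (ssub0-par (pSC p□)))
par-triangle (pnrec {t = t} a b d) = dev-nrec-par (dev t) (par-triangle a) (par-triangle b) (par-triangle d)
par-triangle (pnrec0 {t = t} a d) with dev t | par-triangle d
... | .ze | pze = par-triangle a
par-triangle (pnrecS {t = t} k a b d refl) with dev t | par-triangle d
... | .(S _) | pS d′ with num-inv k d′
...   | refl = subst (_ ⇒_) (sym (dev-nrec-S-num _ _ k))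
                 (papp (papp (par-triangle b) (par-refl _)) (pnrec (par-triangle a) (par-triangle b) (par-refl _)))
par-triangle (pnrecS {t = t} k a b d refl) | _ | pμS d′ _ = ⊥-elim (num≢mu k (num-inv k d′))
par-triangle (pnrecμ {t = t} a b d refl) with dev t | par-triangle d
... | .(mu _) | pmu d′ = pmu (parc-ssub d′ (ssub0-par (pnrecC (par-ren (par-triangle a)) (par-ren (par-triangle b)) p□)))
parc-triangle (pcmd {t = t} d) = dev-cmd-par (dev t) (par-triangle d)
parc-triangle (pcmdμ {t = t} d refl) with dev t | par-triangle d
... | .(mu _) | pmu d′ = parc-ssub d′ ssubγ-par

par-diamond : StronglyCommute (_⇒_ {n} {m}) _⇒_
par-diamond {a = a} a⇒b a⇒c = dev a , par-triangle a⇒b ◅ ε , one-step (par-triangle a⇒c)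

-- Any equation u ≡ ren ρ θ w yields this view (renamed), and matching on the view
-- reveals the shape of w whenever u is a constructor application.
data Renamed (ρ : Fin n₁ → Fin n₂) (θ : Fin m₁ → Fin m₂) : Tm n₂ m₂ → Tm n₁ m₁ → Set where
  rvar  : ∀ {y x} → y ≡ ρ x → Renamed ρ θ (var y) (var x)
  rlam  : ∀ {p p₀} → p ≡ ren (liftR ρ) θ p₀ → Renamed ρ θ (lam p) (lam p₀)
  rapp  : ∀ {t s t₀ s₀} → t ≡ ren ρ θ t₀ → s ≡ ren ρ θ s₀ → Renamed ρ θ (app t s) (app t₀ s₀)
  rmu   : ∀ {c c₀} → c ≡ renc ρ (liftR θ) c₀ → Renamed ρ θ (mu c) (mu c₀)
  rze   : Renamed ρ θ ze ze
  rS    : ∀ {t t₀} → t ≡ ren ρ θ t₀ → Renamed ρ θ (S t) (S t₀)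
  rnrec : ∀ {r s t r₀ s₀ t₀} → r ≡ ren ρ θ r₀ → s ≡ ren ρ θ s₀ → t ≡ ren ρ θ t₀ →
          Renamed ρ θ (nrec r s t) (nrec r₀ s₀ t₀)

renamed : ∀ {ρ : Fin n₁ → Fin n₂} {θ : Fin m₁ → Fin m₂} {u} (w : Tm n₁ m₁) → u ≡ ren ρ θ w → Renamed ρ θ u w
renamed (var x)      refl = rvar refl
renamed (lam t)      refl = rlam refl
renamed (app t s)    refl = rapp refl refl
renamed (mu c)       refl = rmu refl
renamed ze           refl = rze
renamed (S t)        refl = rS refl
renamed (nrec r s t) refl = rnrec refl refl refl

cmd-injective : ∀ {α β : Fin m} {t u : Tm n m} → cmd α t ≡ cmd β u → α ≡ β × t ≡ u
cmd-injective refl = refl , refl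

liftR-injective : ∀ {k l} {ρ : Fin k → Fin l} → Injective _≡_ _≡_ ρ → Injective _≡_ _≡_ (liftR ρ)
liftR-injective i {zero}  {zero}  e = refl
liftR-injective i {suc x} {suc y} e = cong suc (i (suc-injective e))

ren-injective : ∀ {ρ : Fin n₁ → Fin n₂} {θ : Fin m₁ → Fin m₂} → Injective _≡_ _≡_ ρ → Injective _≡_ _≡_ θ →
                ∀ a {b} → ren ρ θ a ≡ ren ρ θ b → a ≡ b
ren-injective i j (var x) {b} e with renamed b e
... | rvar e′ = cong var (i e′)
ren-injective i j (lam t) {b} e with renamed b e
... | rlam e′ = cong lam (ren-injective (liftR-injective i) j t e′)
ren-injective i j (app t s) {b} e with renamed b e
... | rapp e₁ e₂ = cong₂ app (ren-injective i j t e₁) (ren-injective i j s e₂)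
ren-injective i j (mu (cmd α t)) {b} e with renamed b e
... | rmu {c₀ = cmd γ u} e′ with cmd-injective e′
...   | eα , et = cong mu (cong₂ cmd (liftR-injective j eα) (ren-injective i (liftR-injective j) t et))
ren-injective i j ze {b} e with renamed b e
... | rze = refl
ren-injective i j (S t) {b} e with renamed b e
... | rS e′ = cong S (ren-injective i j t e′)
ren-injective i j (nrec r s t) {b} e with renamed b e
... | rnrec e₁ e₂ e₃ =
  cong₂ (λ a b → a b) (cong₂ nrec (ren-injective i j r e₁) (ren-injective i j s e₂)) (ren-injective i j t e₃)

wkμ-injective : ∀ (a : Tm n m) {b} → wkμ a ≡ wkμ b → a ≡ b
wkμ-injective = ren-injective id suc-injective

liftR-preimage : ∀ {K M P} {θ₁ : Fin M → Fin K} {θ₂ : Fin m → Fin K} {π : Fin P → Fin M} →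
                 (∀ α γ → θ₁ α ≡ θ₂ γ → ∃ λ δ → π δ ≡ α) →
                 ∀ α γ → liftR θ₁ α ≡ liftR θ₂ γ → ∃ λ δ → liftR π δ ≡ α
liftR-preimage h zero    γ       e = zero , refl
liftR-preimage h (suc α) zero    ()
liftR-preimage h (suc α) (suc γ) e with h α γ (suc-injective e)
... | δ , refl = suc δ , refl

ren-image : ∀ {N K M P} {ρ₁ : Fin n₁ → Fin N} {ρ₂ : Fin n₂ → Fin N} {θ₁ : Fin M → Fin K} {θ₂ : Fin m₂ → Fin K}
            {π : Fin P → Fin M} → (∀ α γ → θ₁ α ≡ θ₂ γ → ∃ λ δ → π δ ≡ α) →
            ∀ r {q} → ren ρ₁ θ₁ r ≡ ren ρ₂ θ₂ q → ∃ λ r₀ → r ≡ ren id π r₀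
ren-image h (var x) e = var x , refl
ren-image h (lam t) {q} e with renamed q e
... | rlam e′ with ren-image h t e′
...   | t₀ , refl = lam t₀ , cong lam (ren-ext (sym ∘ liftR-id (λ _ → refl)) (λ _ → refl) t₀)
ren-image h (app t s) {q} e with renamed q e
... | rapp e₁ e₂ with ren-image h t e₁ | ren-image h s e₂
...   | t₀ , refl | s₀ , refl = app t₀ s₀ , refl
ren-image h (mu (cmd α t)) {q} e with renamed q e
... | rmu {c₀ = cmd γ u} e′ with cmd-injective e′
...   | eα , et with liftR-preimage h α γ eα | ren-image (liftR-preimage h) t et
...     | δ , refl | t₀ , refl = mu (cmd δ t₀) , refl
ren-image h ze e = ze , refl
ren-image h (S t) {q} e with renamed q e
... | rS e′ with ren-image h t e′
...   | t₀ , refl = S t₀ , refl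
ren-image h (nrec r s t) {q} e with renamed q e
... | rnrec e₁ e₂ e₃ with ren-image h r e₁ | ren-image h s e₂ | ren-image h t e₃
...   | r₀ , refl | s₀ , refl | t₀ , refl = nrec r₀ s₀ t₀ , refl

liftR-suc-preimage : ∀ {θ : Fin m₁ → Fin m₂} α γ → liftR θ α ≡ suc γ → ∃ λ δ → suc δ ≡ α
liftR-suc-preimage zero    γ ()
liftR-suc-preimage (suc α) γ _ = α , refl

unweaken : ∀ {ρ : Fin n₁ → Fin n₂} {θ : Fin m₁ → Fin m₂} (r : Tm n₁ (suc m₁)) {q} →
           ren ρ (liftR θ) r ≡ wkμ q → ∃ λ q₀ → r ≡ wkμ q₀ × q ≡ ren ρ θ q₀
unweaken r {q} e with ren-image {π = suc} liftR-suc-preimage r e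
... | q₀ , refl = q₀ , refl , wkμ-injective q (trans (sym e) (wkμ-ren q₀))

num-unren : ∀ {ρ : Fin n₁ → Fin n₂} {θ : Fin m₁ → Fin m₂} k (w : Tm n₁ m₁) → num k ≡ ren ρ θ w → w ≡ num k
num-unren zero    w e with renamed w e
... | rze = refl
num-unren (suc k) w e with renamed w e
... | rS e′ = cong S (num-unren k _ e′)

par-unren : ∀ {ρ : Fin n₁ → Fin n₂} {θ : Fin m₁ → Fin m₂} (t : Tm n₁ m₁) {u} →
            ren ρ θ t ⇒ u → ∃ λ u₀ → u ≡ ren ρ θ u₀ × t ⇒ u₀
parc-unren : ∀ {ρ : Fin n₁ → Fin n₂} {θ : Fin m₁ → Fin m₂} (c : Cmd n₁ m₁) {u} →
             renc ρ θ c ⇒c u → ∃ λ u₀ → u ≡ renc ρ θ u₀ × c ⇒c u₀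
par-unren-nrec : ∀ {ρ : Fin n₁ → Fin n₂} {θ : Fin m₁ → Fin m₂} (r s t : Tm n₁ m₁) {u} →
                 nrec (ren ρ θ r) (ren ρ θ s) (ren ρ θ t) ⇒ u → ∃ λ u₀ → u ≡ ren ρ θ u₀ × nrec r s t ⇒ u₀
par-unren (var x) pvar = var x , refl , pvar
par-unren (lam t) (plam d) with par-unren t d
... | u₀ , refl , d₀ = lam u₀ , refl , plam d₀
par-unren (app t s) (papp d e) with par-unren t d | par-unren s e
... | t₀ , refl , d₀ | s₀ , refl , e₀ = app t₀ s₀ , refl , papp d₀ e₀
par-unren (app t s) (pβ d e refl) with par-unren t d | par-unren s e
... | w , ew , d₀ | s₀ , refl , e₀ with renamed w ew
...   | rlam {p₀ = p₀} refl = p₀ [ s₀ ] , sym (ren-β p₀ s₀) , pβ d₀ e₀ refl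
par-unren (app t s) (pμapp d e refl) with par-unren t d | par-unren s e
... | w , ew , d₀ | s₀ , refl , e₀ with renamed w ew
...   | rmu {c₀ = c₀} refl =
        mu (ssubc [0≔0 □ · wkμ s₀ ] c₀) , sym (cong mu (ren-ssub0 _ (cong (□ ·_) (wkμ-ren s₀)) c₀)) , pμapp d₀ e₀ refl
par-unren (mu c) (pmu d) with parc-unren c d
... | c₀ , refl , d₀ = mu c₀ , refl , pmu d₀
par-unren ze pze = ze , refl , pze
par-unren (S t) (pS d) with par-unren t d
... | t₀ , refl , d₀ = S t₀ , refl , pS d₀
par-unren (S t) (pμS d refl) with par-unren t d
... | w , ew , d₀ with renamed w ew
...   | rmu {c₀ = c₀} refl = mu (ssubc [0≔0 SC □ ] c₀) , sym (cong mu (ren-ssub0 (SC □) refl c₀)) , pμS d₀ refl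
par-unren (nrec r s t) d = par-unren-nrec r s t d
parc-unren (cmd α t) (pcmd d) with par-unren t d
... | t₀ , refl , d₀ = cmd α t₀ , refl , pcmd d₀
parc-unren (cmd α t) (pcmdμ d refl) with par-unren t d
... | w , ew , d₀ with renamed w ew
...   | rmu {c₀ = c₀} refl = ssubc [0≔ α □] c₀ , sym (ren-ssubγ α c₀) , pcmdμ d₀ refl
-- The nrec cases: a numeral or a μ-abstraction in the renamed argument comes from one.
par-unren-nrec r s t (pnrec a b d) with par-unren r a | par-unren s b | par-unren t d
... | r₀ , refl , a₀ | s₀ , refl , b₀ | t₀ , refl , d₀ = nrec r₀ s₀ t₀ , refl , pnrec a₀ b₀ d₀
par-unren-nrec r s t (pnrec0 a d) with par-unren r a | par-unren t d
... | r₀ , refl , a₀ | w , ew , d₀ with renamed w ew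
...   | rze = r₀ , refl , pnrec0 a₀ d₀
par-unren-nrec r s t (pnrecS k a b d refl) with par-unren r a | par-unren s b | par-unren t d
... | r₀ , refl , a₀ | s₀ , refl , b₀ | w , ew , d₀ with num-unren (suc k) w ew
...   | refl = app (app s₀ (num k)) (nrec r₀ s₀ (num k)) ,
               cong₂ (λ a b → app (app _ a) (nrec _ _ b)) (sym (ren-num k)) (sym (ren-num k)) , pnrecS k a₀ b₀ d₀ refl
par-unren-nrec r s t (pnrecμ a b d refl) with par-unren r a | par-unren s b | par-unren t d
... | r₀ , refl , a₀ | s₀ , refl , b₀ | w , ew , d₀ with renamed w ew
...   | rmu {c₀ = c₀} refl =
        mu (ssubc [0≔0 nrecC (wkμ r₀) (wkμ s₀) □ ] c₀) ,
        sym (cong mu (ren-ssub0 _ (cong₂ (λ a b → nrecC a b □) (wkμ-ren r₀) (wkμ-ren s₀)) c₀)) , pnrecμ a₀ b₀ d₀ refl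

-- It is kept apart from _⇒_: it strongly commutes with _⇒_
-- (par-η-square) and with itself (η-square) instead.
infix 4 _→η_ _→ηc_ _→η*_ _→ηc*_ _→η*E_ _→η*SS_

data _→η_ : Tm n m → Tm n m → Set
data _→ηc_ : Cmd n m → Cmd n m → Set

data _→η_ where
  ηtop  : ∀ {u : Tm n (suc m)} {t : Tm n m} → u ≡ wkμ t → mu (cmd zero u) →η t
  ηlam  : ∀ {t t′ : Tm (suc n) m} → t →η t′ → lam t →η lam t′
  ηappL : ∀ {t t′ s : Tm n m} → t →η t′ → app t s →η app t′ s
  ηappR : ∀ {t s s′ : Tm n m} → s →η s′ → app t s →η app t s′
  ηmu   : ∀ {c c′ : Cmd n (suc m)} → c →ηc c′ → mu c →η mu c′
  ηS    : ∀ {t t′ : Tm n m} → t →η t′ → S t →η S t′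
  ηn1   : ∀ {r r′ s t : Tm n m} → r →η r′ → nrec r s t →η nrec r′ s t
  ηn2   : ∀ {r s s′ t : Tm n m} → s →η s′ → nrec r s t →η nrec r s′ t
  ηn3   : ∀ {r s t t′ : Tm n m} → t →η t′ → nrec r s t →η nrec r s t′

data _→ηc_ where
  ηcmd : ∀ {α : Fin m} {t t′ : Tm n m} → t →η t′ → cmd α t →ηc cmd α t′

_→η*_ : Tm n m → Tm n m → Set
_→η*_ = Star _→η_

_→ηc*_ : Cmd n m → Cmd n m → Set
_→ηc*_ = Star _→ηc_

η*-lam : ∀ {t t′ : Tm (suc n) m} → t →η* t′ → lam t →η* lam t′
η*-lam = gmap lam ηlam

η*-appL : ∀ {t t′ s : Tm n m} → t →η* t′ → app t s →η* app t′ s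
η*-appL = gmap _ ηappL

η*-appR : ∀ {t s s′ : Tm n m} → s →η* s′ → app t s →η* app t s′
η*-appR = gmap _ ηappR

η*-app : ∀ {t t′ s s′ : Tm n m} → t →η* t′ → s →η* s′ → app t s →η* app t′ s′
η*-app ts ss = η*-appL ts ◅◅ η*-appR ss

η*-mu : ∀ {c c′ : Cmd n (suc m)} → c →ηc* c′ → mu c →η* mu c′
η*-mu = gmap mu ηmu

η*-cmd : ∀ {α : Fin m} {t t′ : Tm n m} → t →η* t′ → cmd α t →ηc* cmd α t′
η*-cmd = gmap _ ηcmd

η*-S : ∀ {t t′ : Tm n m} → t →η* t′ → S t →η* S t′
η*-S = gmap S ηS

η*-nrec₁ : ∀ {r r′ s t : Tm n m} → r →η* r′ → nrec r s t →η* nrec r′ s t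
η*-nrec₁ = gmap _ ηn1

η*-nrec₂ : ∀ {r s s′ t : Tm n m} → s →η* s′ → nrec r s t →η* nrec r s′ t
η*-nrec₂ = gmap _ ηn2

η*-nrec₃ : ∀ {r s t t′ : Tm n m} → t →η* t′ → nrec r s t →η* nrec r s t′
η*-nrec₃ = gmap _ ηn3

η*-nrec : ∀ {r r′ s s′ t t′ : Tm n m} → r →η* r′ → s →η* s′ → t →η* t′ → nrec r s t →η* nrec r′ s′ t′
η*-nrec rs ss ts = η*-nrec₁ rs ◅◅ η*-nrec₂ ss ◅◅ η*-nrec₃ ts

η-plug : ∀ (E : Ctx n m) {q q′} → q →η q′ → plug E q →η plug E q′
η-plug □             s = s
η-plug (E · t)       s = ηappL (η-plug E s)
η-plug (SC E)        s = ηS (η-plug E s)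
η-plug (nrecC r x E) s = ηn3 (η-plug E s)

η*-plug : ∀ (E : Ctx n m) {q q′} → q →η* q′ → plug E q →η* plug E q′
η*-plug E = gmap (plug E) (η-plug E)

η-ren : ∀ {ρ : Fin n₁ → Fin n₂} {θ : Fin m₁ → Fin m₂} {t t′} → t →η t′ → ren ρ θ t →η ren ρ θ t′
ηc-ren : ∀ {ρ : Fin n₁ → Fin n₂} {θ : Fin m₁ → Fin m₂} {c c′} → c →ηc c′ → renc ρ θ c →ηc renc ρ θ c′
η-ren {ρ = ρ} {θ} (ηtop {t = q} e) = ηtop (trans (cong (ren ρ (liftR θ)) e) (wkμ-ren q))
η-ren (ηlam s)  = ηlam (η-ren s)
η-ren (ηappL s) = ηappL (η-ren s)
η-ren (ηappR s) = ηappR (η-ren s)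
η-ren (ηmu s)   = ηmu (ηc-ren s)
η-ren (ηS s)    = ηS (η-ren s)
η-ren (ηn1 s)   = ηn1 (η-ren s)
η-ren (ηn2 s)   = ηn2 (η-ren s)
η-ren (ηn3 s)   = ηn3 (η-ren s)
ηc-ren (ηcmd s) = ηcmd (η-ren s)

η*-ren : ∀ {ρ : Fin n₁ → Fin n₂} {θ : Fin m₁ → Fin m₂} {t t′} → t →η* t′ → ren ρ θ t →η* ren ρ θ t′
η*-ren = gmap _ η-ren

η-msub : ∀ {σ : Fin n₁ → Tm n₂ m₂} {τ : SSub n₂ m₁ m₂} {t t′} → t →η t′ → msub σ τ t →η msub σ τ t′
ηc-msub : ∀ {σ : Fin n₁ → Tm n₂ m₂} {τ : SSub n₂ m₁ m₂} {c c′} → c →ηc c′ → msubc σ τ c →ηc msubc σ τ c′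
η-msub {σ = σ} {τ} (ηtop {t = q} e) = ηtop (trans (cong (msub (liftSμ σ) (liftSSμ τ)) e) (msub-wkμ q))
η-msub (ηlam s)  = ηlam (η-msub s)
η-msub (ηappL s) = ηappL (η-msub s)
η-msub (ηappR s) = ηappR (η-msub s)
η-msub (ηmu s)   = ηmu (ηc-msub s)
η-msub (ηS s)    = ηS (η-msub s)
η-msub (ηn1 s)   = ηn1 (η-msub s)
η-msub (ηn2 s)   = ηn2 (η-msub s)
η-msub (ηn3 s)   = ηn3 (η-msub s)
ηc-msub {τ = τ} (ηcmd {α = α} s) = ηcmd (η-plug (proj₂ (τ α)) (η-msub s))

data _→η*E_ {n m : ℕ} : Ctx n m → Ctx n m → Set where
  e□     : □ →η*E □
  e·     : ∀ {E E′ t t′} → E →η*E E′ → t →η* t′ → E · t →η*E E′ · t′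
  eSC    : ∀ {E E′} → E →η*E E′ → SC E →η*E SC E′
  enrecC : ∀ {r r′ s s′ E E′} → r →η* r′ → s →η* s′ → E →η*E E′ → nrecC r s E →η*E nrecC r′ s′ E′

plug-η* : ∀ {E E′ : Ctx n m} {q q′} → E →η*E E′ → q →η* q′ → plug E q →η* plug E′ q′
plug-η* e□                qs = qs
plug-η* (e· Es ts)        qs = η*-app (plug-η* Es qs) ts
plug-η* (eSC Es)          qs = η*-S (plug-η* Es qs)
plug-η* (enrecC rs ss Es) qs = η*-nrec rs ss (plug-η* Es qs)

ctx-η*-ren : ∀ {ρ : Fin n₁ → Fin n₂} {θ : Fin m₁ → Fin m₂} {E E′} → E →η*E E′ → renCtx ρ θ E →η*E renCtx ρ θ E′
ctx-η*-ren e□                = e□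
ctx-η*-ren (e· Es ts)        = e· (ctx-η*-ren Es) (η*-ren ts)
ctx-η*-ren (eSC Es)          = eSC (ctx-η*-ren Es)
ctx-η*-ren (enrecC rs ss Es) = enrecC (η*-ren rs) (η*-ren ss) (ctx-η*-ren Es)

_→η*SS_ : SSub n₂ m₁ m₂ → SSub n₂ m₁ m₂ → Set
τ →η*SS τ′ = ∀ α → (proj₁ (τ α) ≡ proj₁ (τ′ α)) × (proj₂ (τ α) →η*E proj₂ (τ′ α))

msub-η*-args : ∀ {σ σ′ : Fin n₁ → Tm n₂ m₂} {τ τ′ : SSub n₂ m₁ m₂} →
               (∀ x → σ x →η* σ′ x) → τ →η*SS τ′ → ∀ t → msub σ τ t →η* msub σ′ τ′ t
msubc-η*-args : ∀ {σ σ′ : Fin n₁ → Tm n₂ m₂} {τ τ′ : SSub n₂ m₁ m₂} →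
                (∀ x → σ x →η* σ′ x) → τ →η*SS τ′ → ∀ c → msubc σ τ c →ηc* msubc σ′ τ′ c
msub-η*-args σ→ τ→ (var x) = σ→ x
msub-η*-args {σ = σ} {σ′} σ→ τ→ (lam t) =
  η*-lam (msub-η*-args hλ (λ α → proj₁ (τ→ α) , ctx-η*-ren (proj₂ (τ→ α))) t)
  where
  hλ : ∀ x → liftS σ x →η* liftS σ′ x
  hλ zero    = ε
  hλ (suc x) = η*-ren (σ→ x)
msub-η*-args σ→ τ→ (app t s) = η*-app (msub-η*-args σ→ τ→ t) (msub-η*-args σ→ τ→ s)
msub-η*-args {τ = τ} {τ′} σ→ τ→ (mu c) = η*-mu (msubc-η*-args (η*-ren ∘ σ→) hμ c)
  where
  hμ : liftSSμ τ →η*SS liftSSμ τ′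
  hμ zero    = refl , e□
  hμ (suc α) = cong suc (proj₁ (τ→ α)) , ctx-η*-ren (proj₂ (τ→ α))
msub-η*-args σ→ τ→ ze = ε
msub-η*-args σ→ τ→ (S t) = η*-S (msub-η*-args σ→ τ→ t)
msub-η*-args σ→ τ→ (nrec r s t) = η*-nrec (msub-η*-args σ→ τ→ r) (msub-η*-args σ→ τ→ s) (msub-η*-args σ→ τ→ t)
msubc-η*-args {τ = τ} σ→ τ→ (cmd α t) =
  subst (λ γ → τ α ⟨ _ ⟩ →ηc* cmd γ _) (proj₁ (τ→ α)) (η*-cmd (plug-η* (proj₂ (τ→ α)) (msub-η*-args σ→ τ→ t)))

η*-[]-fun : ∀ {p p′ : Tm (suc n) m} {s} → p →η* p′ → p [ s ] →η* p′ [ s ]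
η*-[]-fun {p = p} {p′} {s} ps =
  subst₂ _→η*_ (sym ([]≡msub p s)) (sym ([]≡msub p′ s)) (gmap _ η-msub ps)

η*-[]-arg : ∀ (p : Tm (suc n) m) {s s′} → s →η* s′ → p [ s ] →η* p [ s′ ]
η*-[]-arg p {s} {s′} ss =
  subst₂ _→η*_ (sym ([]≡msub p s)) (sym ([]≡msub p s′))
    (msub-η*-args (λ { zero → ss ; (suc i) → ε }) (λ _ → refl , e□) p)

η*c-ssub : ∀ {τ : SSub n m₁ m₂} {c c′} → c →ηc* c′ → ssubc τ c →ηc* ssubc τ c′
η*c-ssub {τ = τ} {c} {c′} cs =
  subst₂ _→ηc*_ (sym (ssubc≡msubc-var τ c)) (sym (ssubc≡msubc-var τ c′)) (gmap _ ηc-msub cs)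

η*c-ssub0-ctx : ∀ {E E′ : Ctx n (suc m)} → E →η*E E′ → ∀ c → ssubc [0≔0 E ] c →ηc* ssubc [0≔0 E′ ] c
η*c-ssub0-ctx {E = E} {E′} Es c =
  subst₂ _→ηc*_ (sym (ssubc≡msubc-var _ c)) (sym (ssubc≡msubc-var _ c))
    (msubc-η*-args (λ _ → ε) (λ { zero → refl , Es ; (suc α) → refl , e□ }) c)

mu-η* : ∀ {c : Cmd n (suc m)} {d} → mu c →η* d →
        (∃ λ c₁ → d ≡ mu c₁ × c →ηc* c₁) ⊎ (∃ λ q → c →ηc* cmd zero (wkμ q) × q →η* d)
mu-η* ε = inj₁ (_ , refl , ε)
mu-η* (ηtop {t = q} refl ◅ qs) = inj₂ (q , ε , qs)
mu-η* (ηmu s ◅ ss) with mu-η* ss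
... | inj₁ (c₁ , e , cs)  = inj₁ (c₁ , e , s ◅ cs)
... | inj₂ (q , cs , qs)  = inj₂ (q , s ◅ cs , qs)

lam-η* : ∀ {p : Tm (suc n) m} {d} → lam p →η* d → ∃ λ p₀ → d ≡ lam p₀ × p →η* p₀
lam-η* ε = _ , refl , ε
lam-η* (ηlam s ◅ ss) with lam-η* ss
... | p₀ , e , ps = p₀ , e , s ◅ ps

ze-η* : ∀ {d : Tm n m} → ze →η* d → d ≡ ze
ze-η* ε        = refl
ze-η* (() ◅ _)

num-η-normal : ∀ k {x : Tm n m} → num k →η x → ⊥
num-η-normal zero    ()
num-η-normal (suc k) (ηS s) = num-η-normal k s

Snum-η* : ∀ k {d : Tm n m} → S (num k) →η* d → d ≡ S (num k)
Snum-η* k ε            = refl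
Snum-η* k (ηS s ◅ _) = ⊥-elim (num-η-normal k s)

η-unren : ∀ {ρ : Fin n₁ → Fin n₂} {θ : Fin m₁ → Fin m₂} (t : Tm n₁ m₁) {u} →
          ren ρ θ t →η u → ∃ λ u₀ → u ≡ ren ρ θ u₀ × t →η u₀
ηc-unren : ∀ {ρ : Fin n₁ → Fin n₂} {θ : Fin m₁ → Fin m₂} (c : Cmd n₁ m₁) {u} →
           renc ρ θ c →ηc u → ∃ λ u₀ → u ≡ renc ρ θ u₀ × c →ηc u₀
η-unren (mu (cmd zero r)) (ηtop e) with unweaken r e
... | q₀ , refl , e′ = q₀ , e′ , ηtop refl
η-unren (mu c) (ηmu s) with ηc-unren c s
... | c₀ , refl , s₀ = mu c₀ , refl , ηmu s₀
η-unren (lam t) (ηlam s) with η-unren t s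
... | t₀ , refl , s₀ = lam t₀ , refl , ηlam s₀
η-unren (app t x) (ηappL s) with η-unren t s
... | t₀ , refl , s₀ = app t₀ x , refl , ηappL s₀
η-unren (app t x) (ηappR s) with η-unren x s
... | x₀ , refl , s₀ = app t x₀ , refl , ηappR s₀
η-unren (S t) (ηS s) with η-unren t s
... | t₀ , refl , s₀ = S t₀ , refl , ηS s₀
η-unren (nrec r x t) (ηn1 s) with η-unren r s
... | r₀ , refl , s₀ = nrec r₀ x t , refl , ηn1 s₀
η-unren (nrec r x t) (ηn2 s) with η-unren x s
... | x₀ , refl , s₀ = nrec r x₀ t , refl , ηn2 s₀
η-unren (nrec r x t) (ηn3 s) with η-unren t s
... | t₀ , refl , s₀ = nrec r x t₀ , refl , ηn3 s₀
ηc-unren (cmd α t) (ηcmd s) with η-unren t s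
... | t₀ , refl , s₀ = cmd α t₀ , refl , ηcmd s₀

-- μη strongly commutes with itself.  The only overlap is a step inside the top
-- redex μα.[α]t, which is a step of t by anti-renaming.
η-square : StronglyCommute (_→η_ {n} {m}) _→η_
η-square (ηtop e₁) (ηtop e₂) with wkμ-injective _ (trans (sym e₂) e₁)
... | refl = _ , ε , no-step
η-square (ηtop {t = q} refl) (ηmu (ηcmd s)) with η-unren q s
... | q₀ , refl , s₀ = q₀ , s₀ ◅ ε , one-step (ηtop refl)
η-square (ηmu (ηcmd s)) (ηtop {t = q} refl) with η-unren q s
... | q₀ , refl , s₀ = q₀ , ηtop refl ◅ ε , one-step s₀
η-square (ηmu (ηcmd s)) (ηmu (ηcmd s′)) with η-square s s′
... | d , bs , o = mu (cmd _ d) , η*-mu (η*-cmd bs) , map⁼ (ηmu ∘ ηcmd) o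
η-square (ηlam s) (ηlam s′) with η-square s s′
... | d , bs , o = lam d , η*-lam bs , map⁼ ηlam o
η-square (ηappL s) (ηappL s′) with η-square s s′
... | d , bs , o = app d _ , η*-appL bs , map⁼ ηappL o
η-square (ηappL s) (ηappR s′) = _ , ηappR s′ ◅ ε , one-step (ηappL s)
η-square (ηappR s) (ηappL s′) = _ , ηappL s′ ◅ ε , one-step (ηappR s)
η-square (ηappR s) (ηappR s′) with η-square s s′
... | d , bs , o = app _ d , η*-appR bs , map⁼ ηappR o
η-square (ηS s) (ηS s′) with η-square s s′
... | d , bs , o = S d , η*-S bs , map⁼ ηS o
η-square (ηn1 s) (ηn1 s′) with η-square s s′
... | d , bs , o = nrec d _ _ , η*-nrec₁ bs , map⁼ ηn1 o
η-square (ηn1 s) (ηn2 s′) = _ , ηn2 s′ ◅ ε , one-step (ηn1 s)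
η-square (ηn1 s) (ηn3 s′) = _ , ηn3 s′ ◅ ε , one-step (ηn1 s)
η-square (ηn2 s) (ηn1 s′) = _ , ηn1 s′ ◅ ε , one-step (ηn2 s)
η-square (ηn2 s) (ηn2 s′) with η-square s s′
... | d , bs , o = nrec _ d _ , η*-nrec₂ bs , map⁼ ηn2 o
η-square (ηn2 s) (ηn3 s′) = _ , ηn3 s′ ◅ ε , one-step (ηn2 s)
η-square (ηn3 s) (ηn1 s′) = _ , ηn1 s′ ◅ ε , one-step (ηn3 s)
η-square (ηn3 s) (ηn2 s′) = _ , ηn2 s′ ◅ ε , one-step (ηn3 s)
η-square (ηn3 s) (ηn3 s′) with η-square s s′
... | d , bs , o = nrec _ _ d , η*-nrec₃ bs , map⁼ ηn3 o

-- Let E[t] ⇒ μα.c[α ≔ α E′] with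
-- t ⇒ μα.c, and let t →η t′ where the two reducts of t join: μα.c →η* x ⇐ t′.
-- Either the η-steps stay below the binder, or they contract the top μη-redex
-- μα.[α]q, and then the contractum reduces by μη to E′[q] →η* E′[x] ⇐ E[t′].
μ-redex-η : ∀ {E E′ : Ctx n m} {t′ x} {c : Cmd n (suc m)} → E ⇒E E′ → t′ ⇒ x → mu c →η* x →
            ∃ λ d → mu (ssubc [0≔0 wkE E′ ] c) →η* d × plug E t′ ⇒ d
μ-redex-η {E′ = E′} E⇒ t′⇒x ms with mu-η* ms
... | inj₁ (c₁ , refl , cs) = mu (ssubc [0≔0 wkE E′ ] c₁) , η*-mu (η*c-ssub cs) , plug-μ E⇒ t′⇒x
... | inj₂ (q , cs , qs) =
  plug E′ _ , η*-mu (η*c-ssub cs) ◅◅ (ηtop top-redex ◅ η*-plug E′ qs) , plug-par E⇒ t′⇒x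
  where
  top-redex : plug (wkE E′) (ssub [0≔0 wkE E′ ] (wkμ q)) ≡ wkμ (plug E′ q)
  top-redex = trans (cong (plug (wkE E′)) (ssub0-wkμ (wkE E′) q)) (sym (plug-ren E′ q))

par-η-square  : ∀ {a b c : Tm n m} → a ⇒ b → a →η c → ∃ λ d → b →η* d × c ⇒ d
parc-η-square : ∀ {a b c : Cmd n m} → a ⇒c b → a →ηc c → ∃ λ d → b →ηc* d × c ⇒c d
par-η-app     : ∀ {t s b c : Tm n m} → app t s ⇒ b → app t s →η c → ∃ λ d → b →η* d × c ⇒ d
par-η-nrec    : ∀ {r s t b c : Tm n m} → nrec r s t ⇒ b → nrec r s t →η c → ∃ λ d → b →η* d × c ⇒ d
par-η-square {a = app _ _}    a⇒b a→c = par-η-app a⇒b a→c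
par-η-square {a = nrec _ _ _} a⇒b a→c = par-η-nrec a⇒b a→c
par-η-square (pmu (pcmd dd)) (ηtop {t = q} refl) with par-unren q dd
... | q₀ , e , d₀ = q₀ , ηtop e ◅ ε , d₀
par-η-square (pmu (pcmdμ dd refl)) (ηtop {t = q} refl) with par-unren q dd
... | w , ew , d₀ with renamed w ew
...   | rmu {c₀ = c₀} refl = mu c₀ , subst (λ z → mu z →η* mu c₀) (sym (ssubγ-merge c₀)) ε , d₀
par-η-square (pmu d) (ηmu s) with parc-η-square d s
... | x , bs , cd = mu x , η*-mu bs , pmu cd
par-η-square (plam d) (ηlam s) with par-η-square d s
... | x , bs , cd = lam x , η*-lam bs , plam cd
par-η-square (pS d) (ηS s) with par-η-square d s
... | x , bs , cd = S x , η*-S bs , pS cd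
par-η-square (pμS d refl) (ηS s) with par-η-square d s
... | x , ms , cd = μ-redex-η (pSC p□) cd ms
parc-η-square (pcmd d) (ηcmd s) with par-η-square d s
... | x , bs , cd = cmd _ x , η*-cmd bs , pcmd cd
parc-η-square (pcmdμ {α = α} d refl) (ηcmd s) with par-η-square d s
... | x , ms , cd with mu-η* ms
...   | inj₁ (c₁ , refl , cs) = ssubc [0≔ α □] c₁ , η*c-ssub cs , pcmdμ cd refl
...   | inj₂ (q , cs , qs) =
        cmd α x , η*c-ssub cs ◅◅ subst (λ z → cmd α z →ηc* cmd α x) (sym (ssubγ-wkμ α q)) (η*-cmd qs) , pcmd cd

par-η-app (papp d e) (ηappL s) with par-η-square d s
... | x , bs , cd = app x _ , η*-appL bs , papp cd e
par-η-app (pβ d e refl) (ηappL s) with par-η-square d s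
... | x , ls , cd with lam-η* ls
...   | p₀ , refl , ps = p₀ [ _ ] , η*-[]-fun ps , (pβ cd e refl)
par-η-app (pμapp d e refl) (ηappL s) with par-η-square d s
... | x , ms , cd = μ-redex-η (p· p□ e) cd ms
par-η-app (papp d e) (ηappR s) with par-η-square e s
... | x , bs , cd = app _ x , η*-appR bs , papp d cd
par-η-app (pβ {p = p} d e refl) (ηappR s) with par-η-square e s
... | x , bs , cd = p [ x ] , η*-[]-arg p bs , (pβ d cd refl)
par-η-app (pμapp {c = c} d e refl) (ηappR s) with par-η-square e s
... | x , bs , cd =
  mu (ssubc [0≔0 □ · wkμ x ] c) , η*-mu (η*c-ssub0-ctx (e· e□ (η*-ren bs)) c) , (pμapp d cd refl)

par-η-nrec (pnrec a b c) (ηn1 s) with par-η-square a s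
... | x , bs , cd = nrec x _ _ , η*-nrec₁ bs , pnrec cd b c
par-η-nrec (pnrec0 a c) (ηn1 s) with par-η-square a s
... | x , bs , cd = x , bs , pnrec0 cd c
par-η-nrec (pnrecS k a b c refl) (ηn1 s) with par-η-square a s
... | x , bs , cd = app (app _ (num k)) (nrec x _ (num k)) , η*-appR (η*-nrec₁ bs) , pnrecS k cd b c refl
par-η-nrec (pnrecμ {s′ = s′} {c = cc} a b c refl) (ηn1 s) with par-η-square a s
... | x , bs , cd =
  mu (ssubc [0≔0 nrecC (wkμ x) (wkμ s′) □ ] cc) , η*-mu (η*c-ssub0-ctx (enrecC (η*-ren bs) ε e□) cc) ,
  pnrecμ cd b c refl
par-η-nrec (pnrec a b c) (ηn2 s) with par-η-square b s
... | x , bs , cd = nrec _ x _ , η*-nrec₂ bs , pnrec a cd c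
par-η-nrec (pnrec0 a c) (ηn2 s) = _ , ε , pnrec0 a c
par-η-nrec (pnrecS k a b c refl) (ηn2 s) with par-η-square b s
... | x , bs , cd =
  app (app x (num k)) (nrec _ x (num k)) , η*-app (η*-appL bs) (η*-nrec₂ bs) , pnrecS k a cd c refl
par-η-nrec (pnrecμ {r′ = r′} {c = cc} a b c refl) (ηn2 s) with par-η-square b s
... | x , bs , cd =
  mu (ssubc [0≔0 nrecC (wkμ r′) (wkμ x) □ ] cc) , η*-mu (η*c-ssub0-ctx (enrecC ε (η*-ren bs) e□) cc) ,
  pnrecμ a cd c refl
par-η-nrec (pnrec a b c) (ηn3 s) with par-η-square c s
... | x , bs , cd = nrec _ _ x , η*-nrec₃ bs , pnrec a b cd
par-η-nrec (pnrec0 a c) (ηn3 s) with par-η-square c s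
... | x , zs , cd with ze-η* zs
...   | refl = _ , ε , pnrec0 a cd
par-η-nrec (pnrecS k a b c refl) (ηn3 s) with par-η-square c s
... | x , ks , cd with Snum-η* k ks
...   | refl = _ , ε , pnrecS k a b cd refl
par-η-nrec (pnrecμ a b c refl) (ηn3 s) with par-η-square c s
... | x , ms , cd = μ-redex-η (pnrecC a b p□) cd ms

step-split : ∀ {t u : Tm n m} → t ⟶ u → (_⇒_ ∪ _→η_) t u
stepc-split : ∀ {c c′ : Cmd n m} → c ⟶c c′ → (_⇒c_ ∪ _→ηc_) c c′
step-split (β {t = t} {r})        = inj₁ (pβ (par-refl (lam t)) (par-refl r) refl)
step-split (μS {c = c})           = inj₁ (pμS (par-refl (mu c)) refl)
step-split (μapp {c = c} {s})     = inj₁ (pμapp (par-refl (mu c)) (par-refl s) refl)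
step-split μη                     = inj₂ (ηtop refl)
step-split (nrec0 {r = r})        = inj₁ (pnrec0 (par-refl r) pze)
step-split (nrecS {r = r} {s} k)  = inj₁ (pnrecS k (par-refl r) (par-refl s) (par-refl (S (num k))) refl)
step-split (nrecμ {r = r} {s} {c}) = inj₁ (pnrecμ (par-refl r) (par-refl s) (par-refl (mu c)) refl)
step-split (ξlam s)   = Sum.map plam ηlam (step-split s)
step-split (ξappL s)  = Sum.map (λ d → papp d (par-refl _)) ηappL (step-split s)
step-split (ξappR s)  = Sum.map (papp (par-refl _)) ηappR (step-split s)
step-split (ξmu s)    = Sum.map pmu ηmu (stepc-split s)
step-split (ξS s)     = Sum.map pS ηS (step-split s)
step-split (ξnrec₁ s) = Sum.map (λ d → pnrec d (par-refl _) (par-refl _)) ηn1 (step-split s)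
step-split (ξnrec₂ s) = Sum.map (λ d → pnrec (par-refl _) d (par-refl _)) ηn2 (step-split s)
step-split (ξnrec₃ s) = Sum.map (pnrec (par-refl _) (par-refl _)) ηn3 (step-split s)
stepc-split (μcmd {c = c}) = inj₁ (pcmdμ (par-refl (mu c)) refl)
stepc-split (ξcmd s)       = Sum.map pcmd ηcmd (step-split s)

↠-app : ∀ {t t′ s s′ : Tm n m} → t ↠ t′ → s ↠ s′ → app t s ↠ app t′ s′
↠-app ts ss = gmap _ ξappL ts ◅◅ gmap _ ξappR ss

↠-nrec : ∀ {r r′ s s′ t t′ : Tm n m} → r ↠ r′ → s ↠ s′ → t ↠ t′ → nrec r s t ↠ nrec r′ s′ t′
↠-nrec rs ss ts = gmap _ ξnrec₁ rs ◅◅ gmap _ ξnrec₂ ss ◅◅ gmap _ ξnrec₃ ts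

par⇒↠ : ∀ {t u : Tm n m} → t ⇒ u → t ↠ u
parc⇒↠ : ∀ {c c′ : Cmd n m} → c ⇒c c′ → Star _⟶c_ c c′
par⇒↠ pvar                 = ε
par⇒↠ (plam d)             = gmap lam ξlam (par⇒↠ d)
par⇒↠ (papp d e)           = ↠-app (par⇒↠ d) (par⇒↠ e)
par⇒↠ (pβ d e refl)        = ↠-app (par⇒↠ d) (par⇒↠ e) ◅◅ (β ◅ ε)
par⇒↠ (pμapp d e refl)     = ↠-app (par⇒↠ d) (par⇒↠ e) ◅◅ (μapp ◅ ε)
par⇒↠ (pmu d)              = gmap mu ξmu (parc⇒↠ d)
par⇒↠ pze                  = ε
par⇒↠ (pS d)               = gmap S ξS (par⇒↠ d)
par⇒↠ (pμS d refl)         = gmap S ξS (par⇒↠ d) ◅◅ (μS ◅ ε)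
par⇒↠ (pnrec a b c)        = ↠-nrec (par⇒↠ a) (par⇒↠ b) (par⇒↠ c)
par⇒↠ (pnrec0 a c)         = ↠-nrec (par⇒↠ a) ε (par⇒↠ c) ◅◅ (nrec0 ◅ ε)
par⇒↠ (pnrecS k a b c refl) = ↠-nrec (par⇒↠ a) (par⇒↠ b) (par⇒↠ c) ◅◅ (nrecS k ◅ ε)
par⇒↠ (pnrecμ a b c refl)  = ↠-nrec (par⇒↠ a) (par⇒↠ b) (par⇒↠ c) ◅◅ (nrecμ ◅ ε)
parc⇒↠ (pcmd d)            = gmap _ ξcmd (par⇒↠ d)
parc⇒↠ (pcmdμ d refl)      = gmap _ ξcmd (par⇒↠ d) ◅◅ (μcmd ◅ ε)

η⇒⟶ : ∀ {t u : Tm n m} → t →η u → t ⟶ u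
ηc⇒⟶c : ∀ {c c′ : Cmd n m} → c →ηc c′ → c ⟶c c′
η⇒⟶ (ηtop refl) = μη
η⇒⟶ (ηlam s)    = ξlam (η⇒⟶ s)
η⇒⟶ (ηappL s)   = ξappL (η⇒⟶ s)
η⇒⟶ (ηappR s)   = ξappR (η⇒⟶ s)
η⇒⟶ (ηmu s)     = ξmu (ηc⇒⟶c s)
η⇒⟶ (ηS s)      = ξS (η⇒⟶ s)
η⇒⟶ (ηn1 s)     = ξnrec₁ (η⇒⟶ s)
η⇒⟶ (ηn2 s)     = ξnrec₂ (η⇒⟶ s)
η⇒⟶ (ηn3 s)     = ξnrec₃ (η⇒⟶ s)
ηc⇒⟶c (ηcmd s)  = ξcmd (η⇒⟶ s)

split⇒↠ : ∀ {t u : Tm n m} → (_⇒_ ∪ _→η_) t u → t ↠ u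
split⇒↠ = Sum.[ par⇒↠ , (_◅ ε) ∘ η⇒⟶ ]

par-confluent : Confluent (_⇒_ {n} {m})
par-confluent = strongly-commute⇒commute par-diamond

η-confluent : Confluent (_→η_ {n} {m})
η-confluent = strongly-commute⇒commute η-square

par-η-commute : Commute (_⇒_ {n} {m}) _→η_
par-η-commute = strongly-commute⇒commute λ a⇒b a→c →
  let d , bs , c⇒d = par-η-square a⇒b a→c in d , bs , one-step c⇒d

theorem5p16 : ∀ {n m : ℕ} {t₁ t₂ t₃ : Tm n m} →
    t₁ ↠ t₂ → t₁ ↠ t₃ → Σ (Tm n m) (λ t₄ → (t₂ ↠ t₄) × (t₃ ↠ t₄))
theorem5p16 = confluent-between step-split split⇒↠ (hindley-rosen par-confluent η-confluent par-η-commute)
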